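{- Let $K$ be a field with either $\mathrm{char}(K)=0$, or $\mathrm{char}(K)$ odd and $\mathrm{char}(K)\geq d$. Suppose $f\in K[x]$ of degree $d$ is given by $f=A(x-B)g^2$, where $A,B\in K$ and $g=\sum_{i=0}^{n}a_ix^i$ satisfies $\pm a_0=\sqrt{ -\frac{1}{A}}$ and $i(2i-1)Ba_i=-2(n-i+1)(n+i)a_{i-1}$ for $i=1,2,\dots,n$. Then $f$ is $K$-conjugate to $-T_d(x)$.
   Context: $T_d$ denotes the Chebyshev polynomial of degree $d$, defined by $T_d(\cos\theta)=\cos(d\theta)$. Two polynomials $f,g\in K[x]$ are $K$-conjugate if $g=\gamma\circ f\circ\gamma^{ -1}$ for some $\gamma\in\mathrm{PGL}_2(K)$ (here an affine map $\gamma(x)=ux+v$, $u\neq0$). -}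

module Defs where

open import Level using (Level; _⊔_)
open import Algebra.Bundles using (CommutativeRing)
open import Data.Nat as ℕ using (ℕ; zero; suc)
open import Data.List using (List; []; _∷_; map; upTo)
open import Data.Product using (Σ; _×_; ∃; _,_)
open import Data.Sum using (_⊎_)
open import Relation.Nullary using (¬_)

record Field (c ℓ : Level) : Set (Level.suc (c ⊔ ℓ)) where
  field
    commutativeRing : CommutativeRing c ℓ
  open CommutativeRing commutativeRing public
  field
    1≉0    : ¬ (1# ≈ 0#)
    inv    : (x : Carrier) → ¬ (x ≈ 0#) → Carrier
    inv-r  : (x : Carrier) (x≉0 : ¬ (x ≈ 0#)) → x * inv x x≉0 ≈ 1#

module FieldTheory {c ℓ : Level} (K : Field c ℓ) where
  open Field K

  ι : ℕ → Carrier
  ι zero    = 0#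
  ι (suc m) = 1# + ι m

  CharZero : Set ℓ
  CharZero = ∀ m → ¬ (ι (suc m) ≈ 0#)

  HasChar : ℕ → Set ℓ
  HasChar p = (0 ℕ.< p) × (ι p ≈ 0#) × (∀ m → 0 ℕ.< m → m ℕ.< p → ¬ (ι m ≈ 0#))

  -- Polynomials in K[x]: lists of coefficients, constant term first.
  Poly : Set c
  Poly = List Carrier

  coeff : Poly → ℕ → Carrier
  coeff []       _       = 0#
  coeff (a ∷ p)  zero    = a
  coeff (a ∷ p)  (suc k) = coeff p k

  -- equality of polynomials: equal coefficients (trailing zeros irrelevant)
  _≈ₚ_ : Poly → Poly → Set ℓ
  p ≈ₚ q = ∀ k → coeff p k ≈ coeff q k

  HasDegree : Poly → ℕ → Set ℓ
  HasDegree p d = ¬ (coeff p d ≈ 0#) × (∀ k → d ℕ.< k → coeff p k ≈ 0#)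

  const : Carrier → Poly
  const a = a ∷ []

  X : Poly
  X = 0# ∷ 1# ∷ []

  infixl 6 _+ₚ_
  infixl 7 _*ₚ_ _·ₚ_

  _+ₚ_ : Poly → Poly → Poly
  []      +ₚ q       = q
  (a ∷ p) +ₚ []      = a ∷ p
  (a ∷ p) +ₚ (b ∷ q) = (a + b) ∷ (p +ₚ q)

  _·ₚ_ : Carrier → Poly → Poly
  c ·ₚ p = map (c *_) p

  -ₚ_ : Poly → Poly
  -ₚ p = map -_ p

  _*ₚ_ : Poly → Poly → Poly
  []      *ₚ q = []
  (a ∷ p) *ₚ q = (a ·ₚ q) +ₚ (0# ∷ (p *ₚ q))

  _∘ₚ_ : Poly → Poly → Poly
  []      ∘ₚ q = []
  (a ∷ p) ∘ₚ q = const a +ₚ (q *ₚ (p ∘ₚ q))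

  polyOf : (ℕ → Carrier) → ℕ → Poly
  polyOf a n = map a (upTo (suc n))

  T : ℕ → Poly
  T zero          = const 1#
  T (suc zero)    = X
  T (suc (suc k)) = ((ι 2) ·ₚ (X *ₚ T (suc k))) +ₚ (-ₚ T k)

  -- K-conjugacy by an affine map γ(x) = u x + v, u ≠ 0:
  -- g = γ ∘ f ∘ γ⁻¹, with γ⁻¹(x) = u⁻¹ (x - v).
  Conjugate : Poly → Poly → Set (c ⊔ ℓ)
  Conjugate f g =
    Σ Carrier λ u → Σ (¬ (u ≈ 0#)) λ u≉0 → Σ Carrier λ v →
      let γ    = v ∷ u ∷ []
          γinv = (- (inv u u≉0 * v)) ∷ inv u u≉0 ∷ []
      in  g ≈ₚ (γ ∘ₚ (f ∘ₚ γinv))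

{-# OPTIONS --safe #-}
-- Comparing degrees,
-- d = 2m + 1 where m is the degree of g; as equality in K need not be decidable, the vanishing
-- of the coefficients of g above m is proved constructively, by working modulo its top coefficient.
-- The recurrence at i = m + 1 then forces (n − m)(n + m + 1) = 0 in K, so the recurrence also
-- holds with n replaced by m, and since the characteristic exceeds 2m it solves to
-- Bᵏ aₖ = a₀ (−4)ᵏ C(m + k, 2k), that is g (B x) = a₀ Pₘ(x).  Substituting x = (1 + y) / 2 turns
-- Pₘ into ±Wₘ, the Chebyshev polynomial of the fourth kind, and (1 − y) Wₘ(y)² = 1 − T₂ₘ₊₁(y)
-- together with A a₀² = −1 shows γ ∘ f ∘ γ⁻¹ = −T_d for γ x = 2x / B − 1 (a translation if m = 0).
module Submission where

open import Defs
open import Data.Nat as ℕ using (ℕ; suc; _∸_; _≤_; _<_)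
open import Data.List using (List; []; _∷_)
open import Data.Nat.Divisibility using (_∣_)
open import Data.Product using (Σ; _×_; ∃)
open import Data.Sum using (_⊎_)
open import Relation.Nullary using (¬_)
open import Level using (Level)

open import Level using (_⊔_)
open import Algebra.Bundles using (CommutativeRing)
open import Algebra.Solver.Ring.AlmostCommutativeRing using (fromCommutativeRing; _-Raw-AlmostCommutative⟶_)
open import Data.Nat using (zero; z≤n; s≤s; ⌊_/2⌋)
import Data.Nat.Properties as ℕ
open import Data.Nat.Combinatorics using (_C_; nCk+nC[k+1]≡[n+1]C[k+1]; k>n⇒nCk≡0; nC1≡n)
open import Data.Nat.Divisibility using (divides)
open import Data.Nat.Solver using (module +-*-Solver)
open import Data.Integer as ℤ using (ℤ; +_; -[1+_]; _⊖_)
import Data.Integer.Properties as ℤ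
import Data.Sign as Sign
open import Data.Maybe using (Maybe; just; nothing)
open import Data.List using (length; map; applyUpTo)
open import Data.Product using (_,_; proj₁; proj₂)
open import Data.Sum using (inj₁; inj₂)
open import Relation.Nullary using (yes; no; contradiction; ¬¬-excluded-middle)
open import Relation.Nullary.Negation using (¬¬-map; negated-stable)
open import Relation.Nullary.Decidable using (decidable-stable)
open import Relation.Binary.PropositionalEquality as ≡ using (_≡_)
open import Relation.Binary.Definitions using (tri<; tri≈; tri>)

module IntegerCoefficientSolver {c ℓ : Level} (R : CommutativeRing c ℓ) where
  open CommutativeRing R
  open import Algebra.Properties.Ring ring
    using (-0#≈0#; -‿distribˡ-*; -‿distribʳ-*; -‿involutive; -‿+-comm)
  open import Algebra.Properties.Semiring.Mult.TCOptimised semiring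
    using (1+×; ×-homo-+; ×1-homo-*) renaming (_×_ to _×′_)
  open import Relation.Binary.Reasoning.Setoid setoid

  -- The optimised multiple _×′_ sends 1 to 1# and 2 to 1# + 1#, so the constants of
  -- solved equations are literally the ring expressions 1#, 1# + 1#, … used in statements.
  private
    ⟦_⟧ : ℤ → Carrier
    ⟦ + n ⟧      = n ×′ 1#
    ⟦ -[1+ n ] ⟧ = - (suc n ×′ 1#)

    ⟦+◃⟧ : ∀ n → ⟦ Sign.+ ℤ.◃ n ⟧ ≈ n ×′ 1#
    ⟦+◃⟧ zero    = refl
    ⟦+◃⟧ (suc n) = refl

    ⟦-◃⟧ : ∀ n → ⟦ Sign.- ℤ.◃ n ⟧ ≈ - (n ×′ 1#)
    ⟦-◃⟧ zero    = sym -0#≈0#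
    ⟦-◃⟧ (suc n) = refl

    ⟦⊖⟧ : ∀ m n → ⟦ m ⊖ n ⟧ ≈ m ×′ 1# - n ×′ 1#
    ⟦⊖⟧ m       zero    = sym (trans (+-congˡ -0#≈0#) (+-identityʳ _))
    ⟦⊖⟧ zero    (suc n) = sym (+-identityˡ _)
    ⟦⊖⟧ (suc m) (suc n) = begin
      ⟦ suc m ⊖ suc n ⟧               ≡⟨ ≡.cong ⟦_⟧ (ℤ.[1+m]⊖[1+n]≡m⊖n m n) ⟩
      ⟦ m ⊖ n ⟧                       ≈⟨ ⟦⊖⟧ m n ⟩
      m ×′ 1# - n ×′ 1#               ≈⟨ +-congʳ (sym (+-identityˡ _)) ⟩
      0# + m ×′ 1# - n ×′ 1#          ≈⟨ +-congʳ (+-congʳ (sym (-‿inverseʳ 1#))) ⟩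
      (1# - 1#) + m ×′ 1# - n ×′ 1#   ≈⟨ +-congʳ (+-assoc 1# (- 1#) _) ⟩
      1# + (- 1# + m ×′ 1#) - n ×′ 1# ≈⟨ +-congʳ (+-congˡ (+-comm (- 1#) _)) ⟩
      1# + (m ×′ 1# - 1#) - n ×′ 1#   ≈⟨ +-congʳ (sym (+-assoc 1# _ (- 1#))) ⟩
      1# + m ×′ 1# - 1# - n ×′ 1#     ≈⟨ +-assoc _ (- 1#) _ ⟩
      1# + m ×′ 1# + (- 1# - n ×′ 1#) ≈⟨ +-cong (sym (1+× m 1#)) (-‿+-comm 1# _) ⟩
      suc m ×′ 1# - (1# + n ×′ 1#)    ≈⟨ +-congˡ (-‿cong (sym (1+× n 1#))) ⟩
      suc m ×′ 1# - suc n ×′ 1#       ∎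

    +-homo : ∀ i j → ⟦ i ℤ.+ j ⟧ ≈ ⟦ i ⟧ + ⟦ j ⟧
    +-homo (+ m)    (+ n)    = ×-homo-+ 1# m n
    +-homo (+ m)    -[1+ n ] = ⟦⊖⟧ m (suc n)
    +-homo -[1+ m ] (+ n)    = trans (⟦⊖⟧ n (suc m)) (+-comm _ _)
    +-homo -[1+ m ] -[1+ n ] = begin
      - (suc (suc (m ℕ.+ n)) ×′ 1#)     ≡⟨ ≡.cong (λ k → - (suc k ×′ 1#)) (≡.sym (ℕ.+-suc m n)) ⟩
      - ((suc m ℕ.+ suc n) ×′ 1#)       ≈⟨ -‿cong (×-homo-+ 1# (suc m) (suc n)) ⟩
      - (suc m ×′ 1# + suc n ×′ 1#)     ≈⟨ -‿+-comm _ _ ⟨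
      - (suc m ×′ 1#) + - (suc n ×′ 1#) ∎

    *-homo : ∀ i j → ⟦ i ℤ.* j ⟧ ≈ ⟦ i ⟧ * ⟦ j ⟧
    *-homo (+ m) (+ n) = trans (⟦+◃⟧ (m ℕ.* n)) (×1-homo-* m n)
    *-homo (+ m) -[1+ n ] = begin
      ⟦ Sign.- ℤ.◃ (m ℕ.* suc n) ⟧ ≈⟨ ⟦-◃⟧ (m ℕ.* suc n) ⟩
      - ((m ℕ.* suc n) ×′ 1#)      ≈⟨ -‿cong (×1-homo-* m (suc n)) ⟩
      - (m ×′ 1# * suc n ×′ 1#)    ≈⟨ -‿distribʳ-* _ _ ⟩
      m ×′ 1# * - (suc n ×′ 1#)    ∎
    *-homo -[1+ m ] (+ n) = begin
      ⟦ Sign.- ℤ.◃ (suc m ℕ.* n) ⟧ ≈⟨ ⟦-◃⟧ (suc m ℕ.* n) ⟩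
      - ((suc m ℕ.* n) ×′ 1#)      ≈⟨ -‿cong (×1-homo-* (suc m) n) ⟩
      - (suc m ×′ 1# * n ×′ 1#)    ≈⟨ -‿distribˡ-* _ _ ⟩
      - (suc m ×′ 1#) * n ×′ 1#    ∎
    *-homo -[1+ m ] -[1+ n ] = begin
      ⟦ Sign.+ ℤ.◃ (suc m ℕ.* suc n) ⟧  ≈⟨ ⟦+◃⟧ (suc m ℕ.* suc n) ⟩
      (suc m ℕ.* suc n) ×′ 1#           ≈⟨ ×1-homo-* (suc m) (suc n) ⟩
      suc m ×′ 1# * suc n ×′ 1#         ≈⟨ -‿involutive _ ⟨
      - - (suc m ×′ 1# * suc n ×′ 1#)   ≈⟨ -‿cong (-‿distribˡ-* _ _) ⟩
      - (- (suc m ×′ 1#) * suc n ×′ 1#) ≈⟨ -‿distribʳ-* _ _ ⟩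
      - (suc m ×′ 1#) * - (suc n ×′ 1#) ∎

    -‿homo : ∀ i → ⟦ ℤ.- i ⟧ ≈ - ⟦ i ⟧
    -‿homo (+ zero)    = sym -0#≈0#
    -‿homo (+ suc n)   = refl
    -‿homo -[1+ n ]    = sym (-‿involutive _)

    homomorphism : ℤ.+-*-rawRing -Raw-AlmostCommutative⟶ fromCommutativeRing R
    homomorphism = record
      { ⟦_⟧ = ⟦_⟧ ; +-homo = +-homo ; *-homo = *-homo ; -‿homo = -‿homo
      ; 0-homo = refl ; 1-homo = refl }

    ⟦⟧-≟ : ∀ i j → Maybe (⟦ i ⟧ ≈ ⟦ j ⟧)
    ⟦⟧-≟ i j with i ℤ.≟ j
    ... | yes ≡.refl = just refl
    ... | no _       = nothing

  open import Algebra.Solver.Ring ℤ.+-*-rawRing (fromCommutativeRing R) homomorphism ⟦⟧-≟ public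

-- Defined over bare operations, so that rings sharing them (such as quotients of a
-- ring) share their Cauchy products definitionally.
module CauchyProduct {a : Level} {A : Set a} (_+_ _*_ : A → A → A) where
  infixl 7 _⋆_
  _⋆_ : (ℕ → A) → (ℕ → A) → ℕ → A
  (x ⋆ y) zero    = x 0 * y 0
  (x ⋆ y) (suc k) = (x 0 * y (suc k)) + ((λ j → x (suc j)) ⋆ y) k

module Convolution {c ℓ : Level} (R : CommutativeRing c ℓ) where
  open CommutativeRing R
  open IntegerCoefficientSolver R using (solve; _:+_; _:*_; _:=_)
  open CauchyProduct _+_ _*_ public

  VanishesAbove : ℕ → (ℕ → Carrier) → Set ℓ
  VanishesAbove p x = ∀ j → p < j → x j ≈ 0#

  ⋆-cong : ∀ {x x′ y y′} → (∀ j → x j ≈ x′ j) → (∀ j → y j ≈ y′ j) → ∀ k → (x ⋆ y) k ≈ (x′ ⋆ y′) k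
  ⋆-cong x≈ y≈ zero    = *-cong (x≈ 0) (y≈ 0)
  ⋆-cong x≈ y≈ (suc k) = +-cong (*-cong (x≈ 0) (y≈ (suc k))) (⋆-cong (λ j → x≈ (suc j)) y≈ k)

  ⋆-zeroˡ : ∀ {x} y → (∀ j → x j ≈ 0#) → ∀ k → (x ⋆ y) k ≈ 0#
  ⋆-zeroˡ y x≈0 zero    = trans (*-congʳ (x≈0 0)) (zeroˡ _)
  ⋆-zeroˡ y x≈0 (suc k) =
    trans (+-cong (trans (*-congʳ (x≈0 0)) (zeroˡ _)) (⋆-zeroˡ y (λ j → x≈0 (suc j)) k)) (+-identityʳ 0#)

  ⋆-vanishesAbove : ∀ p q {x y} → VanishesAbove p x → VanishesAbove q y → VanishesAbove (p ℕ.+ q) (x ⋆ y)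
  ⋆-vanishesAbove zero q {y = y} x-bd y-bd (suc k) q<1+k =
    trans (+-cong (trans (*-congˡ (y-bd (suc k) q<1+k)) (zeroʳ _)) (⋆-zeroˡ y (λ j → x-bd (suc j) (s≤s z≤n)) k))
          (+-identityʳ 0#)
  ⋆-vanishesAbove (suc p) q x-bd y-bd (suc k) (s≤s p+q<k) =
    trans (+-cong (trans (*-congˡ (y-bd (suc k) (s≤s (ℕ.≤-trans (ℕ.m≤n+m q p) (ℕ.<⇒≤ p+q<k))))) (zeroʳ _))
                  (⋆-vanishesAbove p q (λ j p<j → x-bd (suc j) (s≤s p<j)) y-bd k p+q<k))
          (+-identityʳ 0#)

  ⋆-top : ∀ p q {x y} → VanishesAbove p x → VanishesAbove q y → (x ⋆ y) (p ℕ.+ q) ≈ x p * y q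
  ⋆-top zero zero    x-bd y-bd = refl
  ⋆-top zero (suc q) {y = y} x-bd y-bd =
    trans (+-congˡ (⋆-zeroˡ y (λ j → x-bd (suc j) (s≤s z≤n)) q)) (+-identityʳ _)
  ⋆-top (suc p) q x-bd y-bd =
    trans (+-cong (trans (*-congˡ (y-bd (suc (p ℕ.+ q)) (s≤s (ℕ.m≤n+m q p)))) (zeroʳ _))
                  (⋆-top p q (λ j p<j → x-bd (suc j) (s≤s p<j)) y-bd))
          (+-identityˡ _)

  ⋆-distribʳ-+ : ∀ x x′ y k → ((λ j → x j + x′ j) ⋆ y) k ≈ (x ⋆ y) k + (x′ ⋆ y) k
  ⋆-distribʳ-+ x x′ y zero    = distribʳ _ _ _
  ⋆-distribʳ-+ x x′ y (suc k) =
    trans (+-cong (distribʳ _ _ _) (⋆-distribʳ-+ (λ j → x (suc j)) (λ j → x′ (suc j)) y k))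
          (solve 4 (λ a b c d → (a :+ b) :+ (c :+ d) := (a :+ c) :+ (b :+ d)) refl _ _ _ _)

  ⋆-distribˡ-+ : ∀ x y y′ k → (x ⋆ (λ j → y j + y′ j)) k ≈ (x ⋆ y) k + (x ⋆ y′) k
  ⋆-distribˡ-+ x y y′ zero    = distribˡ _ _ _
  ⋆-distribˡ-+ x y y′ (suc k) =
    trans (+-cong (distribˡ _ _ _) (⋆-distribˡ-+ (λ j → x (suc j)) y y′ k))
          (solve 4 (λ a b c d → (a :+ b) :+ (c :+ d) := (a :+ c) :+ (b :+ d)) refl _ _ _ _)

  ⋆-scaleˡ : ∀ g x y k → ((λ j → g * x j) ⋆ y) k ≈ g * (x ⋆ y) k
  ⋆-scaleˡ g x y zero    = *-assoc _ _ _
  ⋆-scaleˡ g x y (suc k) =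
    trans (+-cong (*-assoc _ _ _) (⋆-scaleˡ g (λ j → x (suc j)) y k)) (sym (distribˡ _ _ _))

  ⋆-scaleʳ : ∀ g x y k → (x ⋆ (λ j → g * y j)) k ≈ g * (x ⋆ y) k
  ⋆-scaleʳ g x y zero    = solve 3 (λ a b c → a :* (b :* c) := b :* (a :* c)) refl _ _ _
  ⋆-scaleʳ g x y (suc k) =
    trans (+-cong (solve 3 (λ a b c → a :* (b :* c) := b :* (a :* c)) refl _ _ _) (⋆-scaleʳ g (λ j → x (suc j)) y k))
          (sym (distribˡ _ _ _))

module Quotient {c ℓ : Level} (R : CommutativeRing c ℓ) where
  open CommutativeRing R
  open IntegerCoefficientSolver R using (solve; _:+_; _:*_; :-_; _:=_; con)

  infix 4 _≈_mod_
  _≈_mod_ : Carrier → Carrier → Carrier → Set (c ⊔ ℓ)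
  x ≈ y mod g = Σ Carrier λ z → x - y ≈ g * z

  ≈⇒≈mod : ∀ {g x y} → x ≈ y → x ≈ y mod g
  ≈⇒≈mod {g} {x} {y} x≈y = 0# , trans (+-congʳ x≈y) (solve 2 (λ y g → y :+ (:- y) := g :* con (+ 0)) refl y g)

  private
    ≈mod-sym : ∀ {g x y} → x ≈ y mod g → y ≈ x mod g
    ≈mod-sym {g} {x} {y} (z , x-y≈gz) =
      - z , trans (solve 2 (λ x y → y :+ (:- x) := :- (x :+ (:- y))) refl x y)
                  (trans (-‿cong x-y≈gz) (solve 2 (λ g z → :- (g :* z) := g :* (:- z)) refl g z))

    ≈mod-trans : ∀ {g x y w} → x ≈ y mod g → y ≈ w mod g → x ≈ w mod g
    ≈mod-trans {g} {x} {y} {w} (z₁ , e₁) (z₂ , e₂) =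
      z₁ + z₂ , trans (solve 3 (λ x y w → x :+ (:- w) := (x :+ (:- y)) :+ (y :+ (:- w))) refl x y w)
                      (trans (+-cong e₁ e₂) (sym (distribˡ _ _ _)))

    +-cong-mod : ∀ {g x y u v} → x ≈ y mod g → u ≈ v mod g → x + u ≈ y + v mod g
    +-cong-mod {g} {x} {y} {u} {v} (z₁ , e₁) (z₂ , e₂) =
      z₁ + z₂ , trans (solve 4 (λ x y u v → (x :+ u) :+ (:- (y :+ v)) := (x :+ (:- y)) :+ (u :+ (:- v))) refl x y u v)
                      (trans (+-cong e₁ e₂) (sym (distribˡ _ _ _)))

    *-cong-mod : ∀ {g x y u v} → x ≈ y mod g → u ≈ v mod g → x * u ≈ y * v mod g
    *-cong-mod {g} {x} {y} {u} {v} (z₁ , e₁) (z₂ , e₂) =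
      z₁ * u + y * z₂ ,
      trans (solve 4 (λ x y u v → (x :* u) :+ (:- (y :* v)) := (x :+ (:- y)) :* u :+ y :* (u :+ (:- v))) refl x y u v)
            (trans (+-cong (*-congʳ e₁) (*-congˡ e₂))
                   (solve 5 (λ g z₁ z₂ u y → g :* z₁ :* u :+ y :* (g :* z₂) := g :* (z₁ :* u :+ y :* z₂)) refl g z₁ z₂ u y))

    -‿cong-mod : ∀ {g x y} → x ≈ y mod g → - x ≈ - y mod g
    -‿cong-mod {g} {x} {y} (z , e) =
      - z , trans (solve 2 (λ x y → (:- x) :+ (:- (:- y)) := :- (x :+ (:- y))) refl x y)
                  (trans (-‿cong e) (solve 2 (λ g z → :- (g :* z) := g :* (:- z)) refl g z))

  quotientRing : Carrier → CommutativeRing c (c ⊔ ℓ)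
  quotientRing g = record
    { Carrier = Carrier ; _≈_ = _≈_mod g ; _+_ = _+_ ; _*_ = _*_ ; -_ = -_ ; 0# = 0# ; 1# = 1#
    ; isCommutativeRing = record
      { isRing = record
        { +-isAbelianGroup = record
          { isGroup = record
            { isMonoid = record
              { isSemigroup = record
                { isMagma = record
                  { isEquivalence = record { refl = ≈⇒≈mod refl ; sym = ≈mod-sym ; trans = ≈mod-trans }
                  ; ∙-cong = +-cong-mod }
                ; assoc = λ x y z → ≈⇒≈mod (+-assoc x y z) }
              ; identity = (λ x → ≈⇒≈mod (+-identityˡ x)) , (λ x → ≈⇒≈mod (+-identityʳ x)) }
            ; inverse = (λ x → ≈⇒≈mod (-‿inverseˡ x)) , (λ x → ≈⇒≈mod (-‿inverseʳ x))
            ; ⁻¹-cong = -‿cong-mod }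
          ; comm = λ x y → ≈⇒≈mod (+-comm x y) }
        ; *-cong = *-cong-mod
        ; *-assoc = λ x y z → ≈⇒≈mod (*-assoc x y z)
        ; *-identity = (λ x → ≈⇒≈mod (*-identityˡ x)) , (λ x → ≈⇒≈mod (*-identityʳ x))
        ; distrib = (λ x y z → ≈⇒≈mod (distribˡ x y z)) , (λ x y z → ≈⇒≈mod (distribʳ x y z)) }
      ; *-comm = λ x y → ≈⇒≈mod (*-comm x y) } }

module SquareStep {c ℓ : Level} (R : CommutativeRing c ℓ) where
  open CommutativeRing R
  open Convolution R
  open Quotient R using (_≈_mod_)
  open IntegerCoefficientSolver R using (solve; _:+_; _:*_; :-_; _:=_; con)
  open import Relation.Binary.Reasoning.Setoid setoid

  -- Write a = low + g · quot with low the truncation of a at m and g = a n.  The coefficient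
  -- of index n + m of a² is then 2 · a m · g + g² · (quot ⋆ quot) (n + m), where g² = (a ⋆ a) (2n)
  -- vanishes; as 2 · a m is a unit, g vanishes, and with it every a j, j > m.
  module _ {m n : ℕ} (m<n : m < n) (a : ℕ → Carrier) {w : Carrier}
           (unit : (1# + 1#) * a m * w ≈ 1#)
           (a-bd : VanishesAbove n a) (a²-bd : VanishesAbove (m ℕ.+ m) (a ⋆ a))
           (multiple : ∀ j → m < j → a j ≈ 0# mod a n) where

    private
      g = a n

      low high quot : ℕ → Carrier
      low j with j ℕ.≤? m
      ... | yes _ = a j
      ... | no  _ = 0#
      high j with j ℕ.≤? m
      ... | yes _ = 0#
      ... | no  _ = a j
      quot j with j ℕ.≤? m
      ... | yes _   = 0#
      ... | no  j≰m = proj₁ (multiple j (ℕ.≰⇒> j≰m))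

      split : ∀ j → a j ≈ low j + high j
      split j with j ℕ.≤? m
      ... | yes _ = sym (+-identityʳ _)
      ... | no  _ = sym (+-identityˡ _)

      high≈g*quot : ∀ j → high j ≈ g * quot j
      high≈g*quot j with j ℕ.≤? m
      ... | yes _   = sym (zeroʳ g)
      ... | no  j≰m = trans (solve 1 (λ x → x := x :+ (:- con (+ 0))) refl (a j)) (proj₂ (multiple j (ℕ.≰⇒> j≰m)))

      low-bd : VanishesAbove m low
      low-bd j m<j with j ℕ.≤? m
      ... | yes j≤m = contradiction j≤m (ℕ.<⇒≱ m<j)
      ... | no  _   = refl

      high-bd : VanishesAbove n high
      high-bd j n<j with j ℕ.≤? m
      ... | yes _ = refl
      ... | no  _ = a-bd j n<j

      low-top : low m ≈ a m
      low-top with m ℕ.≤? m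
      ... | yes _   = refl
      ... | no  m≰m = contradiction ℕ.≤-refl m≰m

      high-top : high n ≈ g
      high-top with n ℕ.≤? m
      ... | yes n≤m = contradiction n≤m (ℕ.<⇒≱ m<n)
      ... | no  _   = refl

      g²≈0 : g * g ≈ 0#
      g²≈0 = trans (sym (⋆-top n n a-bd a-bd)) (a²-bd (n ℕ.+ n) (ℕ.+-mono-< m<n m<n))

      k = n ℕ.+ m
      2m<k : m ℕ.+ m < k
      2m<k = ℕ.+-monoˡ-< m m<n

      coefficient : (a ⋆ a) k ≈ (0# + a m * g) + (g * a m + g * (g * (quot ⋆ quot) k))
      coefficient = begin
        (a ⋆ a) k                                      ≈⟨ ⋆-cong split split k ⟩
        ((λ j → low j + high j) ⋆ (λ j → low j + high j)) k
          ≈⟨ ⋆-distribʳ-+ low high _ k ⟩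
        (low ⋆ (λ j → low j + high j)) k + (high ⋆ (λ j → low j + high j)) k
          ≈⟨ +-cong (⋆-distribˡ-+ low low high k) (⋆-distribˡ-+ high low high k) ⟩
        ((low ⋆ low) k + (low ⋆ high) k) + ((high ⋆ low) k + (high ⋆ high) k)
          ≈⟨ +-cong (+-cong (⋆-vanishesAbove m m low-bd low-bd k 2m<k) low⋆high)
                    (+-cong (trans (⋆-top n m high-bd low-bd) (*-cong high-top low-top)) high⋆high) ⟩
        (0# + a m * g) + (g * a m + g * (g * (quot ⋆ quot) k)) ∎
        where
        low⋆high : (low ⋆ high) k ≈ a m * g
        low⋆high = trans (≡.subst (λ i → (low ⋆ high) k ≈ (low ⋆ high) i) (ℕ.+-comm n m) refl)
                         (trans (⋆-top m n low-bd high-bd) (*-cong low-top high-top))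
        high⋆high : (high ⋆ high) k ≈ g * (g * (quot ⋆ quot) k)
        high⋆high = trans (⋆-cong high≈g*quot high≈g*quot k)
                          (trans (⋆-scaleˡ g quot _ k) (*-congˡ (⋆-scaleʳ g quot quot k)))

      2am*g≈0 : (1# + 1#) * a m * g ≈ 0#
      2am*g≈0 = begin
        (1# + 1#) * a m * g
          ≈⟨ solve 3 (λ x g q → con (+ 2) :* x :* g
                              := (con (+ 0) :+ x :* g :+ (g :* x :+ g :* (g :* q))) :+ (:- ((g :* g) :* q)))
                   refl (a m) g ((quot ⋆ quot) k) ⟩
        ((0# + a m * g) + (g * a m + g * (g * (quot ⋆ quot) k))) - g * g * (quot ⋆ quot) k
          ≈⟨ +-cong (trans (sym coefficient) (a²-bd k 2m<k)) (-‿cong (trans (*-congʳ g²≈0) (zeroˡ _))) ⟩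
        0# - 0#                                        ≈⟨ -‿inverseʳ 0# ⟩
        0#                                             ∎

      g≈0 : g ≈ 0#
      g≈0 = begin
        g                                ≈⟨ *-identityˡ g ⟨
        1# * g                           ≈⟨ *-congʳ unit ⟨
        (1# + 1#) * a m * w * g          ≈⟨ solve 3 (λ x w g → con (+ 2) :* x :* w :* g := w :* (con (+ 2) :* x :* g))
                                                  refl (a m) w g ⟩
        w * ((1# + 1#) * a m * g)        ≈⟨ *-congˡ 2am*g≈0 ⟩
        w * 0#                           ≈⟨ zeroʳ w ⟩
        0#                               ∎

    vanishesAbove-step : VanishesAbove m a
    vanishesAbove-step j m<j = begin
      a j                         ≈⟨ solve 1 (λ x → x := x :+ (:- con (+ 0))) refl (a j) ⟩
      a j - 0#                    ≈⟨ proj₂ (multiple j m<j) ⟩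
      g * proj₁ (multiple j m<j)  ≈⟨ *-congʳ g≈0 ⟩
      0# * proj₁ (multiple j m<j) ≈⟨ zeroˡ _ ⟩
      0#                          ∎

-- Induction on e: over R/(a n) with n = m + e + 1 the hypotheses hold for e, so every a j
-- with j > m is a multiple of a n, and SquareStep applies.
vanishesAbove-of-square : ∀ e {c ℓ} (R : CommutativeRing c ℓ) →
  let open CommutativeRing R; open Convolution R in
  ∀ {m} (a : ℕ → Carrier) {w} → (1# + 1#) * a m * w ≈ 1# →
  VanishesAbove (m ℕ.+ e) a → VanishesAbove (m ℕ.+ m) (a ⋆ a) → VanishesAbove m a
vanishesAbove-of-square zero R {m} a unit a-bd a²-bd j m<j =
  a-bd j (≡.subst (_< j) (≡.sym (ℕ.+-identityʳ m)) m<j)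
vanishesAbove-of-square (suc e) {c} {ℓ} R {m} a unit a-bd a²-bd =
  SquareStep.vanishesAbove-step R (ℕ.m<m+n m (s≤s z≤n)) a unit a-bd a²-bd
    (vanishesAbove-of-square e {c} {c ⊔ ℓ} (quotientRing (a n)) a (≈⇒≈mod unit) a-bd-mod
                             (λ k 2m<k → ≈⇒≈mod (a²-bd k 2m<k)))
  where
  open CommutativeRing R
  open Quotient R
  open IntegerCoefficientSolver R using (solve; _:+_; _:*_; :-_; _:=_; con)
  n = m ℕ.+ suc e
  a-bd-mod : ∀ j → m ℕ.+ e < j → a j ≈ 0# mod a n
  a-bd-mod j m+e<j with ℕ.m≤n⇒m<n∨m≡n m+e<j
  ... | inj₁ n<j  = ≈⇒≈mod (a-bd j (≡.subst (_< j) (≡.sym (ℕ.+-suc m e)) n<j))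
  ... | inj₂ n≡j  = 1# , ≡.subst (λ i → a i - 0# ≈ a n * 1#) (≡.trans (ℕ.+-suc m e) n≡j)
                               (solve 1 (λ x → x :+ (:- con (+ 0)) := x :* con (+ 1)) refl (a n))

module ChebyshevIdentity {c ℓ : Level} (R : CommutativeRing c ℓ) where
  open CommutativeRing R
  open IntegerCoefficientSolver R using (solve; _:+_; _:*_; :-_; _:=_; con)
  open import Relation.Binary.Reasoning.Setoid setoid

  -- With y = cos θ, t k = cos (k θ) and r m = (-1)ᵐ sin ((m + ½) θ) / sin (θ / 2), so that
  -- the identity below is 2 sin² ((m + ½) θ) = 1 - cos ((2m + 1) θ).
  module _ (y : Carrier) {t r : ℕ → Carrier}
    (t₀ : t 0 ≈ 1#) (t₁ : t 1 ≈ y) (t-rec : ∀ k → t (suc (suc k)) ≈ (y + y) * t (suc k) - t k)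
    (r₀ : r 0 ≈ 1#) (r₁ : r 1 ≈ - (y + y) - 1#) (r-rec : ∀ k → r (suc (suc k)) ≈ - (y + y) * r (suc k) - r k)
    where

    private
      1-y = 1# - y

      Invariant : ℕ → Set ℓ
      Invariant m = (1-y * (r m * r m) ≈ 1# - t (suc (m ℕ.+ m)))
                  × (1-y * (r m * r (suc m)) ≈ t (suc (suc (m ℕ.+ m))) - y)
                  × (1-y * (r (suc m) * r (suc m)) ≈ 1# - t (suc (suc (suc (m ℕ.+ m)))))

      invariant-zero : Invariant 0
      invariant-zero = square₀ , product₀ , square₁
        where
        t₂ : t 2 ≈ (y + y) * y - 1#
        t₂ = trans (t-rec 0) (+-cong (*-congˡ t₁) (-‿cong t₀))
        t₃ : t 3 ≈ (y + y) * ((y + y) * y - 1#) - y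
        t₃ = trans (t-rec 1) (+-cong (*-congˡ t₂) (-‿cong t₁))
        square₀ : 1-y * (r 0 * r 0) ≈ 1# - t 1
        square₀ = begin
          1-y * (r 0 * r 0)  ≈⟨ *-congˡ (*-cong r₀ r₀) ⟩
          1-y * (1# * 1#)    ≈⟨ solve 1 (λ y → (con (+ 1) :+ :- y) :* (con (+ 1) :* con (+ 1)) := con (+ 1) :+ :- y) refl y ⟩
          1# - y             ≈⟨ +-congˡ (-‿cong (sym t₁)) ⟩
          1# - t 1           ∎
        product₀ : 1-y * (r 0 * r 1) ≈ t 2 - y
        product₀ = begin
          1-y * (r 0 * r 1)              ≈⟨ *-congˡ (*-cong r₀ r₁) ⟩
          1-y * (1# * (- (y + y) - 1#))  ≈⟨ solve 1 (λ y → (con (+ 1) :+ :- y) :* (con (+ 1) :* (:- (y :+ y) :+ :- con (+ 1)))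
                                                         := ((y :+ y) :* y :+ :- con (+ 1)) :+ :- y) refl y ⟩
          ((y + y) * y - 1#) - y         ≈⟨ +-congʳ (sym t₂) ⟩
          t 2 - y                        ∎
        square₁ : 1-y * (r 1 * r 1) ≈ 1# - t 3
        square₁ = begin
          1-y * (r 1 * r 1)
            ≈⟨ *-congˡ (*-cong r₁ r₁) ⟩
          1-y * ((- (y + y) - 1#) * (- (y + y) - 1#))
            ≈⟨ solve 1 (λ y → (con (+ 1) :+ :- y) :* ((:- (y :+ y) :+ :- con (+ 1)) :* (:- (y :+ y) :+ :- con (+ 1)))
                            := con (+ 1) :+ :- ((y :+ y) :* ((y :+ y) :* y :+ :- con (+ 1)) :+ :- y)) refl y ⟩
          1# - ((y + y) * ((y + y) * y - 1#) - y)
            ≈⟨ +-congˡ (-‿cong (sym t₃)) ⟩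
          1# - t 3
            ∎

      invariant-suc : ∀ m → Invariant m → Invariant (suc m)
      invariant-suc m (square₀ , product₀ , square₁) rewrite ℕ.+-suc m m = square₁ , product₁ , square₂
        where
        r₀′ = r m
        r₁′ = r (suc m)
        t₁′ = t (suc (m ℕ.+ m))
        t₂′ = t (suc (suc (m ℕ.+ m)))
        t₃′ = t (suc (suc (suc (m ℕ.+ m))))
        t₄′ = t (suc (suc (suc (suc (m ℕ.+ m)))))
        t₅′ = t (suc (suc (suc (suc (suc (m ℕ.+ m))))))
        t₃-rec : t₃′ ≈ (y + y) * t₂′ - t₁′
        t₃-rec = t-rec (suc (m ℕ.+ m))
        t₄-rec : t₄′ ≈ (y + y) * t₃′ - t₂′
        t₄-rec = t-rec (suc (suc (m ℕ.+ m)))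
        t₅-rec : t₅′ ≈ (y + y) * ((y + y) * t₃′ - t₂′) - t₃′
        t₅-rec = trans (t-rec (suc (suc (suc (m ℕ.+ m))))) (+-congʳ (*-congˡ t₄-rec))

        product₁ : 1-y * (r₁′ * r (suc (suc m))) ≈ t₄′ - y
        product₁ = begin
          1-y * (r₁′ * r (suc (suc m)))
            ≈⟨ *-congˡ (*-congˡ (r-rec m)) ⟩
          1-y * (r₁′ * (- (y + y) * r₁′ - r₀′))
            ≈⟨ solve 3 (λ y a b → (con (+ 1) :+ :- y) :* (b :* (:- (y :+ y) :* b :+ :- a))
                                := :- (y :+ y) :* ((con (+ 1) :+ :- y) :* (b :* b)) :+ :- ((con (+ 1) :+ :- y) :* (a :* b)))
                     refl y r₀′ r₁′ ⟩
          - (y + y) * (1-y * (r₁′ * r₁′)) - 1-y * (r₀′ * r₁′)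
            ≈⟨ +-cong (*-congˡ square₁) (-‿cong product₀) ⟩
          - (y + y) * (1# - t₃′) - (t₂′ - y)
            ≈⟨ solve 3 (λ y a b → :- (y :+ y) :* (con (+ 1) :+ :- b) :+ :- (a :+ :- y) := ((y :+ y) :* b :+ :- a) :+ :- y)
                     refl y t₂′ t₃′ ⟩
          ((y + y) * t₃′ - t₂′) - y
            ≈⟨ +-congʳ (sym t₄-rec) ⟩
          t₄′ - y
            ∎

        square₂ : 1-y * (r (suc (suc m)) * r (suc (suc m))) ≈ 1# - t₅′
        square₂ = begin
          1-y * (r (suc (suc m)) * r (suc (suc m)))
            ≈⟨ *-congˡ (*-cong (r-rec m) (r-rec m)) ⟩
          1-y * ((- (y + y) * r₁′ - r₀′) * (- (y + y) * r₁′ - r₀′))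
            ≈⟨ solve 3 (λ y a b → (con (+ 1) :+ :- y) :* ((:- (y :+ y) :* b :+ :- a) :* (:- (y :+ y) :* b :+ :- a))
                                := ((y :+ y) :* (y :+ y)) :* ((con (+ 1) :+ :- y) :* (b :* b))
                                   :+ ((y :+ y) :+ (y :+ y)) :* ((con (+ 1) :+ :- y) :* (a :* b))
                                   :+ (con (+ 1) :+ :- y) :* (a :* a)) refl y r₀′ r₁′ ⟩
          ((y + y) * (y + y)) * (1-y * (r₁′ * r₁′)) + ((y + y) + (y + y)) * (1-y * (r₀′ * r₁′)) + 1-y * (r₀′ * r₀′)
            ≈⟨ +-cong (+-cong (*-congˡ square₁) (*-congˡ product₀)) square₀ ⟩
          ((y + y) * (y + y)) * (1# - t₃′) + ((y + y) + (y + y)) * (t₂′ - y) + (1# - t₁′)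
            ≈⟨ +-congʳ (+-congʳ (*-congˡ (+-congˡ (-‿cong t₃-rec)))) ⟩
          ((y + y) * (y + y)) * (1# - ((y + y) * t₂′ - t₁′)) + ((y + y) + (y + y)) * (t₂′ - y) + (1# - t₁′)
            ≈⟨ solve 3 (λ y a b → ((y :+ y) :* (y :+ y)) :* (con (+ 1) :+ :- ((y :+ y) :* b :+ :- a))
                                   :+ ((y :+ y) :+ (y :+ y)) :* (b :+ :- y) :+ (con (+ 1) :+ :- a)
                                := con (+ 1) :+ :- ((y :+ y) :* ((y :+ y) :* ((y :+ y) :* b :+ :- a) :+ :- b)
                                                    :+ :- ((y :+ y) :* b :+ :- a))) refl y t₁′ t₂′ ⟩
          1# - ((y + y) * ((y + y) * ((y + y) * t₂′ - t₁′) - t₂′) - ((y + y) * t₂′ - t₁′))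
            ≈⟨ +-congˡ (-‿cong (+-cong (*-congˡ (+-congʳ (*-congˡ (sym t₃-rec)))) (-‿cong (sym t₃-rec)))) ⟩
          1# - ((y + y) * ((y + y) * t₃′ - t₂′) - t₃′)
            ≈⟨ +-congˡ (-‿cong (sym t₅-rec)) ⟩
          1# - t₅′
            ∎

      invariant : ∀ m → Invariant m
      invariant zero    = invariant-zero
      invariant (suc m) = invariant-suc m (invariant m)

    1-y*r²≈1-t[2m+1] : ∀ m → (1# - y) * (r m * r m) ≈ 1# - t (suc (m ℕ.+ m))
    1-y*r²≈1-t[2m+1] m = proj₁ (invariant m)

module Binomial where
  open import Data.Nat using (_+_; _*_)
  open import Data.Nat.Properties
  open import Relation.Binary.PropositionalEquality
  open +-*-Solver
  open ≡-Reasoning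

  [1+k]*[1+n]C[1+k]≡[1+n]*nCk : ∀ n k → suc k * (suc n C suc k) ≡ suc n * (n C k)
  [1+k]*[1+n]C[1+k]≡[1+n]*nCk zero    zero    = refl
  [1+k]*[1+n]C[1+k]≡[1+n]*nCk zero    (suc k) = *-zeroʳ (suc (suc k))
  [1+k]*[1+n]C[1+k]≡[1+n]*nCk (suc n) zero    = trans (+-identityʳ _) (trans (nC1≡n (suc (suc n))) (sym (*-identityʳ _)))
  [1+k]*[1+n]C[1+k]≡[1+n]*nCk (suc n) (suc k) = begin
    suc (suc k) * (suc (suc n) C suc (suc k))
      ≡⟨ cong (suc (suc k) *_) (nCk+nC[k+1]≡[n+1]C[k+1] (suc n) (suc k)) ⟨
    suc (suc k) * (suc n C suc k + suc n C suc (suc k))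
      ≡⟨ *-distribˡ-+ (suc (suc k)) (suc n C suc k) _ ⟩
    suc (suc k) * (suc n C suc k) + suc (suc k) * (suc n C suc (suc k))
      ≡⟨⟩
    suc n C suc k + suc k * (suc n C suc k) + suc (suc k) * (suc n C suc (suc k))
      ≡⟨ cong₂ (λ x y → suc n C suc k + x + y) ([1+k]*[1+n]C[1+k]≡[1+n]*nCk n k) ([1+k]*[1+n]C[1+k]≡[1+n]*nCk n (suc k)) ⟩
    suc n C suc k + suc n * (n C k) + suc n * (n C suc k)
      ≡⟨ solve 4 (λ a b c d → a :+ b :* c :+ b :* d := a :+ b :* (c :+ d)) refl (suc n C suc k) (suc n) (n C k) (n C suc k) ⟩
    suc n C suc k + suc n * (n C k + n C suc k)
      ≡⟨ cong (λ x → suc n C suc k + suc n * x) (nCk+nC[k+1]≡[n+1]C[k+1] n k) ⟩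
    suc (suc n) * (suc n C suc k)
      ∎

  [1+k]*[k+s]C[1+k]≡s*[k+s]Ck : ∀ k s → suc k * ((k + s) C suc k) ≡ s * ((k + s) C k)
  [1+k]*[k+s]C[1+k]≡s*[k+s]Ck k s = +-cancelˡ-≡ (suc k * ((k + s) C k)) _ _ (begin
    suc k * ((k + s) C k) + suc k * ((k + s) C suc k) ≡⟨ *-distribˡ-+ (suc k) ((k + s) C k) ((k + s) C suc k) ⟨
    suc k * ((k + s) C k + (k + s) C suc k)          ≡⟨ cong (suc k *_) (nCk+nC[k+1]≡[n+1]C[k+1] (k + s) k) ⟩
    suc k * (suc (k + s) C suc k)                     ≡⟨ [1+k]*[1+n]C[1+k]≡[1+n]*nCk (k + s) k ⟩
    suc (k + s) * ((k + s) C k)                       ≡⟨ solve 3 (λ k s b → (con 1 :+ (k :+ s)) :* b := (con 1 :+ k) :* b :+ s :* b)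
                                                                 refl k s ((k + s) C k) ⟩
    suc k * ((k + s) C k) + s * ((k + s) C k)         ∎)

  [2+j]*[1+j]*[1+j+s]C[2+j]≡[1+j+s]*s*[j+s]Cj :
    ∀ j s → suc (suc j) * suc j * (suc (j + s) C suc (suc j)) ≡ suc (j + s) * s * ((j + s) C j)
  [2+j]*[1+j]*[1+j+s]C[2+j]≡[1+j+s]*s*[j+s]Cj j s = begin
    suc (suc j) * suc j * (suc (j + s) C suc (suc j))  ≡⟨ solve 3 (λ a b c → a :* b :* c := b :* (a :* c)) refl (suc (suc j)) (suc j) _ ⟩
    suc j * (suc (suc j) * (suc (j + s) C suc (suc j))) ≡⟨ cong (suc j *_) ([1+k]*[1+n]C[1+k]≡[1+n]*nCk (j + s) (suc j)) ⟩
    suc j * (suc (j + s) * ((j + s) C suc j))           ≡⟨ solve 3 (λ a b c → a :* (b :* c) := b :* (a :* c))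
                                                                   refl (suc j) (suc (j + s)) _ ⟩
    suc (j + s) * (suc j * ((j + s) C suc j))           ≡⟨ cong (suc (j + s) *_) ([1+k]*[k+s]C[1+k]≡s*[k+s]Ck j s) ⟩
    suc (j + s) * (s * ((j + s) C j))                   ≡⟨ *-assoc (suc (j + s)) s _ ⟨
    suc (j + s) * s * ((j + s) C j)                     ∎

  [2+n]C[2+k]+nC[2+k]≡2*[1+n]C[2+k]+nCk :
    ∀ n k → suc (suc n) C suc (suc k) + n C suc (suc k) ≡ suc n C suc (suc k) + suc n C suc (suc k) + n C k
  [2+n]C[2+k]+nC[2+k]≡2*[1+n]C[2+k]+nCk n k = begin
    suc (suc n) C suc (suc k) + n C suc (suc k)
      ≡⟨ cong (_+ n C suc (suc k)) (nCk+nC[k+1]≡[n+1]C[k+1] (suc n) (suc k)) ⟨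
    suc n C suc k + suc n C suc (suc k) + n C suc (suc k)
      ≡⟨ cong (λ x → x + suc n C suc (suc k) + n C suc (suc k)) (nCk+nC[k+1]≡[n+1]C[k+1] n k) ⟨
    n C k + n C suc k + suc n C suc (suc k) + n C suc (suc k)
      ≡⟨ solve 4 (λ a b c d → a :+ b :+ c :+ d := c :+ (b :+ d) :+ a) refl (n C k) (n C suc k) (suc n C suc (suc k)) (n C suc (suc k)) ⟩
    suc n C suc (suc k) + (n C suc k + n C suc (suc k)) + n C k
      ≡⟨ cong (λ x → suc n C suc (suc k) + x + n C k) (nCk+nC[k+1]≡[n+1]C[k+1] n (suc k)) ⟩
    suc n C suc (suc k) + suc n C suc (suc k) + n C k
      ∎

module FieldProperties {c ℓ : Level} (K : Field c ℓ) where
  open Field K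

  *-cancelˡ : ∀ {x y z} → ¬ x ≈ 0# → x * y ≈ x * z → y ≈ z
  *-cancelˡ {x} {y} {z} x≉0 xy≈xz = begin
    y                   ≈⟨ *-identityˡ y ⟨
    1# * y              ≈⟨ *-congʳ (trans (*-comm _ _) (inv-r x x≉0)) ⟨
    (inv x x≉0 * x) * y ≈⟨ *-assoc _ _ _ ⟩
    inv x x≉0 * (x * y) ≈⟨ *-congˡ xy≈xz ⟩
    inv x x≉0 * (x * z) ≈⟨ *-assoc _ _ _ ⟨
    (inv x x≉0 * x) * z ≈⟨ *-congʳ (trans (*-comm _ _) (inv-r x x≉0)) ⟩
    1# * z              ≈⟨ *-identityˡ z ⟩
    z                   ∎
    where open import Relation.Binary.Reasoning.Setoid setoid

  *-≉0 : ∀ {x y} → ¬ x ≈ 0# → ¬ y ≈ 0# → ¬ x * y ≈ 0#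
  *-≉0 {x} x≉0 y≉0 xy≈0 = y≉0 (*-cancelˡ x≉0 (trans xy≈0 (sym (zeroʳ x))))

module PolynomialRing {c ℓ : Level} (K : Field c ℓ) where
  open Field K hiding (zero)
  open FieldTheory K
  open Convolution commutativeRing
  open IntegerCoefficientSolver commutativeRing using (solve; _:+_; _:*_; _:=_)

  -- _≈ₚ_ wrapped in a record, so that its arguments can be inferred from it.
  infix 4 _≋_
  record _≋_ (p q : Poly) : Set ℓ where
    constructor coeffwise
    field get : p ≈ₚ q
  open _≋_ public

  ≋-refl : ∀ {p} → p ≋ p
  ≋-refl = coeffwise λ _ → refl

  ≋-sym : ∀ {p q} → p ≋ q → q ≋ p
  ≋-sym (coeffwise p≈q) = coeffwise λ k → sym (p≈q k)

  ≋-trans : ∀ {p q r} → p ≋ q → q ≋ r → p ≋ r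
  ≋-trans (coeffwise p≈q) (coeffwise q≈r) = coeffwise λ k → trans (p≈q k) (q≈r k)

  ∷-cong : ∀ {a b p q} → a ≈ b → p ≋ q → (a ∷ p) ≋ (b ∷ q)
  ∷-cong a≈b (coeffwise p≈q) = coeffwise λ { zero → a≈b ; (suc k) → p≈q k }

  coeff-+ₚ : ∀ p q k → coeff (p +ₚ q) k ≈ coeff p k + coeff q k
  coeff-+ₚ []      q       k       = sym (+-identityˡ _)
  coeff-+ₚ (a ∷ p) []      k       = sym (+-identityʳ _)
  coeff-+ₚ (a ∷ p) (b ∷ q) zero    = refl
  coeff-+ₚ (a ∷ p) (b ∷ q) (suc k) = coeff-+ₚ p q k

  coeff-·ₚ : ∀ a p k → coeff (a ·ₚ p) k ≈ a * coeff p k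
  coeff-·ₚ a []      k       = sym (zeroʳ a)
  coeff-·ₚ a (b ∷ p) zero    = refl
  coeff-·ₚ a (b ∷ p) (suc k) = coeff-·ₚ a p k

  coeff--ₚ : ∀ p k → coeff (-ₚ p) k ≈ - coeff p k
  coeff--ₚ []      k       = sym (trans (sym (+-identityˡ _)) (-‿inverseʳ 0#))
  coeff--ₚ (b ∷ p) zero    = refl
  coeff--ₚ (b ∷ p) (suc k) = coeff--ₚ p k

  coeff-*ₚ : ∀ p q k → coeff (p *ₚ q) k ≈ (coeff p ⋆ coeff q) k
  coeff-*ₚ []      q k       = sym (⋆-zeroˡ (coeff q) (λ _ → refl) k)
  coeff-*ₚ (a ∷ p) q zero    = trans (coeff-+ₚ (a ·ₚ q) (0# ∷ (p *ₚ q)) zero) (trans (+-identityʳ _) (coeff-·ₚ a q zero))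
  coeff-*ₚ (a ∷ p) q (suc k) =
    trans (coeff-+ₚ (a ·ₚ q) (0# ∷ (p *ₚ q)) (suc k)) (+-cong (coeff-·ₚ a q (suc k)) (coeff-*ₚ p q k))

  +ₚ-cong : ∀ {p p′ q q′} → p ≋ p′ → q ≋ q′ → p +ₚ q ≋ p′ +ₚ q′
  +ₚ-cong {p} {p′} {q} {q′} (coeffwise p≈p′) (coeffwise q≈q′) =
    coeffwise λ k → trans (coeff-+ₚ p q k) (trans (+-cong (p≈p′ k) (q≈q′ k)) (sym (coeff-+ₚ p′ q′ k)))

  -ₚ-cong : ∀ {p q} → p ≋ q → -ₚ p ≋ -ₚ q
  -ₚ-cong {p} {q} (coeffwise p≈q) =
    coeffwise λ k → trans (coeff--ₚ p k) (trans (-‿cong (p≈q k)) (sym (coeff--ₚ q k)))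

  *ₚ-cong : ∀ {p p′ q q′} → p ≋ p′ → q ≋ q′ → p *ₚ q ≋ p′ *ₚ q′
  *ₚ-cong {p} {p′} {q} {q′} (coeffwise p≈p′) (coeffwise q≈q′) =
    coeffwise λ k → trans (coeff-*ₚ p q k) (trans (⋆-cong p≈p′ q≈q′ k) (sym (coeff-*ₚ p′ q′ k)))

  +ₚ-congˡ : ∀ p {q q′} → q ≋ q′ → p +ₚ q ≋ p +ₚ q′
  +ₚ-congˡ p = +ₚ-cong (≋-refl {p})

  +ₚ-congʳ : ∀ {p p′} q → p ≋ p′ → p +ₚ q ≋ p′ +ₚ q
  +ₚ-congʳ q p≋p′ = +ₚ-cong p≋p′ (≋-refl {q})

  *ₚ-congˡ : ∀ p {q q′} → q ≋ q′ → p *ₚ q ≋ p *ₚ q′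
  *ₚ-congˡ p = *ₚ-cong (≋-refl {p})

  *ₚ-congʳ : ∀ {p p′} q → p ≋ p′ → p *ₚ q ≋ p′ *ₚ q
  *ₚ-congʳ q p≋p′ = *ₚ-cong p≋p′ (≋-refl {q})

  +ₚ-assoc : ∀ p q r → (p +ₚ q) +ₚ r ≋ p +ₚ (q +ₚ r)
  +ₚ-assoc p q r = coeffwise λ k → begin
    coeff ((p +ₚ q) +ₚ r) k              ≈⟨ trans (coeff-+ₚ (p +ₚ q) r k) (+-congʳ (coeff-+ₚ p q k)) ⟩
    (coeff p k + coeff q k) + coeff r k  ≈⟨ +-assoc _ _ _ ⟩
    coeff p k + (coeff q k + coeff r k)  ≈⟨ sym (trans (coeff-+ₚ p (q +ₚ r) k) (+-congˡ (coeff-+ₚ q r k))) ⟩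
    coeff (p +ₚ (q +ₚ r)) k              ∎
    where open import Relation.Binary.Reasoning.Setoid setoid

  +ₚ-comm : ∀ p q → p +ₚ q ≋ q +ₚ p
  +ₚ-comm p q = coeffwise λ k → trans (coeff-+ₚ p q k) (trans (+-comm _ _) (sym (coeff-+ₚ q p k)))

  +ₚ-identityʳ : ∀ p → p +ₚ [] ≋ p
  +ₚ-identityʳ p = coeffwise λ k → trans (coeff-+ₚ p [] k) (+-identityʳ _)

  -ₚ-inverseˡ : ∀ p → (-ₚ p) +ₚ p ≋ []
  -ₚ-inverseˡ p = coeffwise λ k → trans (coeff-+ₚ (-ₚ p) p k) (trans (+-congʳ (coeff--ₚ p k)) (-‿inverseˡ _))

  -ₚ-inverseʳ : ∀ p → p +ₚ (-ₚ p) ≋ []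
  -ₚ-inverseʳ p = ≋-trans (+ₚ-comm p (-ₚ p)) (-ₚ-inverseˡ p)

  *ₚ-distribʳ-+ₚ : ∀ p q r → (q +ₚ r) *ₚ p ≋ (q *ₚ p) +ₚ (r *ₚ p)
  *ₚ-distribʳ-+ₚ p q r = coeffwise λ k →
    trans (coeff-*ₚ (q +ₚ r) p k)
      (trans (⋆-cong (coeff-+ₚ q r) (λ _ → refl) k)
        (trans (⋆-distribʳ-+ (coeff q) (coeff r) (coeff p) k)
          (sym (trans (coeff-+ₚ (q *ₚ p) (r *ₚ p) k) (+-cong (coeff-*ₚ q p k) (coeff-*ₚ r p k))))))

  ·ₚ-distribˡ-+ₚ : ∀ a p q → a ·ₚ (p +ₚ q) ≋ (a ·ₚ p) +ₚ (a ·ₚ q)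
  ·ₚ-distribˡ-+ₚ a p q = coeffwise λ k →
    trans (coeff-·ₚ a (p +ₚ q) k)
      (trans (*-congˡ (coeff-+ₚ p q k))
        (trans (distribˡ _ _ _) (sym (trans (coeff-+ₚ (a ·ₚ p) (a ·ₚ q) k) (+-cong (coeff-·ₚ a p k) (coeff-·ₚ a q k))))))

  ·ₚ-assoc : ∀ a b p → a ·ₚ (b ·ₚ p) ≋ (a * b) ·ₚ p
  ·ₚ-assoc a b p = coeffwise λ k →
    trans (coeff-·ₚ a (b ·ₚ p) k) (trans (*-congˡ (coeff-·ₚ b p k)) (trans (sym (*-assoc _ _ _)) (sym (coeff-·ₚ (a * b) p k))))

  ·ₚ-*ₚ : ∀ a p q → (a ·ₚ p) *ₚ q ≋ a ·ₚ (p *ₚ q)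
  ·ₚ-*ₚ a []      q = ≋-refl
  ·ₚ-*ₚ a (b ∷ p) q =
    ≋-trans (+ₚ-cong (≋-sym (·ₚ-assoc a b q)) (∷-cong (sym (zeroʳ a)) (·ₚ-*ₚ a p q)))
            (≋-sym (·ₚ-distribˡ-+ₚ a (b ·ₚ q) (0# ∷ (p *ₚ q))))

  0∷-*ₚ : ∀ p q → (0# ∷ p) *ₚ q ≋ 0# ∷ (p *ₚ q)
  0∷-*ₚ p q = coeffwise λ k →
    trans (coeff-+ₚ (0# ·ₚ q) (0# ∷ (p *ₚ q)) k) (trans (+-congʳ (trans (coeff-·ₚ 0# q k) (zeroˡ _))) (+-identityˡ _))

  *ₚ-assoc : ∀ p q r → (p *ₚ q) *ₚ r ≋ p *ₚ (q *ₚ r)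
  *ₚ-assoc []      q r = ≋-refl
  *ₚ-assoc (a ∷ p) q r =
    ≋-trans (*ₚ-distribʳ-+ₚ r (a ·ₚ q) (0# ∷ (p *ₚ q)))
            (+ₚ-cong (·ₚ-*ₚ a q r) (≋-trans (0∷-*ₚ (p *ₚ q) r) (∷-cong refl (*ₚ-assoc p q r))))

  *ₚ-zeroʳ : ∀ p → p *ₚ [] ≋ []
  *ₚ-zeroʳ []      = ≋-refl
  *ₚ-zeroʳ (a ∷ p) = coeffwise λ { zero → refl ; (suc k) → get (*ₚ-zeroʳ p) k }

  const-0# : const 0# ≋ []
  const-0# = coeffwise λ { zero → refl ; (suc k) → refl }

  *ₚ-identityˡ : ∀ p → const 1# *ₚ p ≋ p
  *ₚ-identityˡ p = coeffwise λ k →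
    trans (coeff-+ₚ (1# ·ₚ p) (0# ∷ []) k)
      (trans (+-cong (trans (coeff-·ₚ 1# p k) (*-identityˡ _)) (get const-0# k)) (+-identityʳ _))

  *ₚ-∷ʳ : ∀ p b q → p *ₚ (b ∷ q) ≋ (b ·ₚ p) +ₚ (0# ∷ (p *ₚ q))
  *ₚ-∷ʳ []      b q = coeffwise λ { zero → refl ; (suc k) → refl }
  *ₚ-∷ʳ (a ∷ p) b q = coeffwise λ
    { zero → trans (+-identityʳ _) (trans (*-comm a b) (sym (+-identityʳ _)))
    ; (suc k) → begin
        coeff ((a ·ₚ q) +ₚ (p *ₚ (b ∷ q))) k
          ≈⟨ trans (coeff-+ₚ (a ·ₚ q) (p *ₚ (b ∷ q)) k) (+-congʳ (coeff-·ₚ a q k)) ⟩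
        a * coeff q k + coeff (p *ₚ (b ∷ q)) k
          ≈⟨ +-congˡ (trans (get (*ₚ-∷ʳ p b q) k) (coeff-+ₚ (b ·ₚ p) (0# ∷ (p *ₚ q)) k)) ⟩
        a * coeff q k + (coeff (b ·ₚ p) k + coeff (0# ∷ (p *ₚ q)) k)
          ≈⟨ solve 3 (λ x y z → x :+ (y :+ z) := y :+ (x :+ z)) refl _ _ _ ⟩
        coeff (b ·ₚ p) k + (a * coeff q k + coeff (0# ∷ (p *ₚ q)) k)
          ≈⟨ +-congˡ (sym (trans (coeff-+ₚ (a ·ₚ q) (0# ∷ (p *ₚ q)) k) (+-congʳ (coeff-·ₚ a q k)))) ⟩
        coeff (b ·ₚ p) k + coeff ((a ∷ p) *ₚ q) k
          ≈⟨ sym (coeff-+ₚ (b ·ₚ p) ((a ∷ p) *ₚ q) k) ⟩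
        coeff ((b ·ₚ p) +ₚ ((a ∷ p) *ₚ q)) k ∎ }
    where open import Relation.Binary.Reasoning.Setoid setoid

  *ₚ-comm : ∀ p q → p *ₚ q ≋ q *ₚ p
  *ₚ-comm []      q = ≋-sym (*ₚ-zeroʳ q)
  *ₚ-comm (a ∷ p) q = ≋-trans (+ₚ-cong ≋-refl (∷-cong refl (*ₚ-comm p q))) (≋-sym (*ₚ-∷ʳ q a p))

  polynomialRing : CommutativeRing c ℓ
  polynomialRing = record
    { Carrier = Poly ; _≈_ = _≋_ ; _+_ = _+ₚ_ ; _*_ = _*ₚ_ ; -_ = -ₚ_ ; 0# = [] ; 1# = const 1#
    ; isCommutativeRing = record
      { isRing = record
        { +-isAbelianGroup = record
          { isGroup = record
            { isMonoid = record
              { isSemigroup = record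
                { isMagma = record
                  { isEquivalence = record { refl = ≋-refl ; sym = ≋-sym ; trans = ≋-trans }
                  ; ∙-cong = +ₚ-cong }
                ; assoc = +ₚ-assoc }
              ; identity = (λ _ → ≋-refl) , +ₚ-identityʳ }
            ; inverse = -ₚ-inverseˡ , -ₚ-inverseʳ
            ; ⁻¹-cong = -ₚ-cong }
          ; comm = +ₚ-comm }
        ; *-cong = *ₚ-cong
        ; *-assoc = *ₚ-assoc
        ; *-identity = *ₚ-identityˡ , (λ p → ≋-trans (*ₚ-comm p _) (*ₚ-identityˡ p))
        ; distrib = (λ p q r → ≋-trans (*ₚ-comm p _) (≋-trans (*ₚ-distribʳ-+ₚ p q r) (+ₚ-cong (*ₚ-comm q p) (*ₚ-comm r p))))
                  , *ₚ-distribʳ-+ₚ }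
      ; *-comm = *ₚ-comm } }

  ·ₚ≋const-*ₚ : ∀ a p → a ·ₚ p ≋ const a *ₚ p
  ·ₚ≋const-*ₚ a p = ≋-sym (≋-trans (+ₚ-cong ≋-refl const-0#) (+ₚ-identityʳ _))

  const-*ₚ : ∀ a b → const a *ₚ const b ≋ const (a * b)
  const-*ₚ a b = ∷-cong (+-identityʳ _) ≋-refl

  open IntegerCoefficientSolver polynomialRing using ()
    renaming (solve to solveₚ; _:+_ to _⊕_; _:*_ to _⊛_; :-_ to ⊝_; _:=_ to _≐_; con to κ)

  private
    ∘ₚ-[] : ∀ p q → p ≋ [] → p ∘ₚ q ≋ []
    ∘ₚ-[] []      q _             = ≋-refl
    ∘ₚ-[] (a ∷ p) q (coeffwise e) =
      ≋-trans (+ₚ-cong (∷-cong (e zero) ≋-refl) (≋-trans (*ₚ-congˡ q (∘ₚ-[] p q (coeffwise λ k → e (suc k)))) (*ₚ-zeroʳ q)))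
              (≋-trans (+ₚ-identityʳ _) const-0#)

  ∘ₚ-congˡ : ∀ {p p′} q → p ≋ p′ → p ∘ₚ q ≋ p′ ∘ₚ q
  ∘ₚ-congˡ {[]}    {[]}      q _ = ≋-refl
  ∘ₚ-congˡ {[]}    {a′ ∷ p′} q e = ≋-sym (∘ₚ-[] (a′ ∷ p′) q (≋-sym e))
  ∘ₚ-congˡ {a ∷ p} {[]}      q e = ∘ₚ-[] (a ∷ p) q e
  ∘ₚ-congˡ {a ∷ p} {a′ ∷ p′} q (coeffwise e) =
    +ₚ-cong (∷-cong (e zero) ≋-refl) (*ₚ-congˡ q (∘ₚ-congˡ {p} {p′} q (coeffwise λ k → e (suc k))))

  ∘ₚ-congʳ : ∀ p {q q′} → q ≋ q′ → p ∘ₚ q ≋ p ∘ₚ q′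
  ∘ₚ-congʳ []      _    = ≋-refl
  ∘ₚ-congʳ (a ∷ p) q≋q′ = +ₚ-cong ≋-refl (*ₚ-cong q≋q′ (∘ₚ-congʳ p q≋q′))

  const-∘ₚ : ∀ a q → const a ∘ₚ q ≋ const a
  const-∘ₚ a q = ≋-trans (+ₚ-cong ≋-refl (*ₚ-zeroʳ q)) (+ₚ-identityʳ _)

  ∘ₚ-homo-+ₚ : ∀ p p′ q → (p +ₚ p′) ∘ₚ q ≋ (p ∘ₚ q) +ₚ (p′ ∘ₚ q)
  ∘ₚ-homo-+ₚ []      p′       q = ≋-refl
  ∘ₚ-homo-+ₚ (a ∷ p) []       q = ≋-sym (+ₚ-identityʳ _)
  ∘ₚ-homo-+ₚ (a ∷ p) (a′ ∷ p′) q =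
    ≋-trans (+ₚ-cong ≋-refl (*ₚ-congˡ q (∘ₚ-homo-+ₚ p p′ q)))
            (solveₚ 5 (λ A A′ Q P P′ → (A ⊕ A′) ⊕ Q ⊛ (P ⊕ P′) ≐ (A ⊕ Q ⊛ P) ⊕ (A′ ⊕ Q ⊛ P′))
                    ≋-refl (const a) (const a′) q (p ∘ₚ q) (p′ ∘ₚ q))

  ∘ₚ-homo--ₚ : ∀ p q → (-ₚ p) ∘ₚ q ≋ -ₚ (p ∘ₚ q)
  ∘ₚ-homo--ₚ []      q = ≋-refl
  ∘ₚ-homo--ₚ (a ∷ p) q =
    ≋-trans (+ₚ-cong ≋-refl (*ₚ-congˡ q (∘ₚ-homo--ₚ p q)))
            (solveₚ 3 (λ A Q P → (⊝ A) ⊕ Q ⊛ (⊝ P) ≐ ⊝ (A ⊕ Q ⊛ P)) ≋-refl (const a) q (p ∘ₚ q))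

  ·ₚ-∘ₚ : ∀ a p q → (a ·ₚ p) ∘ₚ q ≋ const a *ₚ (p ∘ₚ q)
  ·ₚ-∘ₚ a []      q = ≋-sym (*ₚ-zeroʳ (const a))
  ·ₚ-∘ₚ a (b ∷ p) q =
    ≋-trans (+ₚ-cong (∷-cong (sym (+-identityʳ _)) ≋-refl) (*ₚ-congˡ q (·ₚ-∘ₚ a p q)))
            (solveₚ 4 (λ A B Q P → A ⊛ B ⊕ Q ⊛ (A ⊛ P) ≐ A ⊛ (B ⊕ Q ⊛ P)) ≋-refl (const a) (const b) q (p ∘ₚ q))

  ∘ₚ-homo-*ₚ : ∀ p p′ q → (p *ₚ p′) ∘ₚ q ≋ (p ∘ₚ q) *ₚ (p′ ∘ₚ q)
  ∘ₚ-homo-*ₚ []      p′ q = ≋-refl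
  ∘ₚ-homo-*ₚ (a ∷ p) p′ q =
    ≋-trans (∘ₚ-homo-+ₚ (a ·ₚ p′) (0# ∷ (p *ₚ p′)) q)
      (≋-trans (+ₚ-cong (·ₚ-∘ₚ a p′ q) (+ₚ-cong const-0# (*ₚ-congˡ q (∘ₚ-homo-*ₚ p p′ q))))
        (solveₚ 4 (λ A Q P P′ → A ⊛ P′ ⊕ (κ (+ 0) ⊕ Q ⊛ (P ⊛ P′)) ≐ (A ⊕ Q ⊛ P) ⊛ P′)
                  ≋-refl (const a) q (p ∘ₚ q) (p′ ∘ₚ q)))

  coeff-polyOf : ∀ a {n k} → k ≤ n → coeff (polyOf a n) k ≡ a k
  coeff-polyOf a {n} k≤n = go (λ i → i) (suc n) (s≤s k≤n)
    where
    go : ∀ g m {k} → k < m → coeff (map a (applyUpTo g m)) k ≡ a (g k)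
    go g (suc m) {zero}  _         = ≡.refl
    go g (suc m) {suc k} (s≤s k<m) = go (λ i → g (suc i)) m k<m

  polyOf-vanishesAbove : ∀ a {n k} → n < k → coeff (polyOf a n) k ≡ 0#
  polyOf-vanishesAbove a {n} = go (λ i → i) (suc n)
    where
    go : ∀ g m {k} → m ≤ k → coeff (map a (applyUpTo g m)) k ≡ 0#
    go g zero    _               = ≡.refl
    go g (suc m) {suc k} (s≤s m≤k) = go (λ i → g (suc i)) m m≤k

module Degrees {c ℓ : Level} (K : Field c ℓ) where
  open Field K hiding (zero)
  open FieldTheory K
  open FieldProperties K
  open Convolution commutativeRing
  open PolynomialRing K

  HasDegree-resp : ∀ {p q d} → p ≋ q → HasDegree p d → HasDegree q d
  HasDegree-resp (coeffwise p≈q) (top≉0 , above≈0) =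
    (λ top≈0 → top≉0 (trans (p≈q _) top≈0)) , (λ k d<k → trans (sym (p≈q k)) (above≈0 k d<k))

  HasDegree-unique : ∀ p {d e} → HasDegree p d → HasDegree p e → d ≡ e
  HasDegree-unique p {d} {e} (d-top , d-above) (e-top , e-above) with ℕ.<-cmp d e
  ... | tri< d<e _ _ = contradiction (d-above e d<e) e-top
  ... | tri≈ _ d≡e _ = d≡e
  ... | tri> _ _ e<d = contradiction (e-above d e<d) d-top

  ·ₚ-HasDegree⁻¹ : ∀ {a} p {d} → ¬ a ≈ 0# → HasDegree (a ·ₚ p) d → HasDegree p d
  ·ₚ-HasDegree⁻¹ {a} p {d} a≉0 (top≉0 , above≈0) =
    (λ top≈0 → top≉0 (trans (coeff-·ₚ a p d) (trans (*-congˡ top≈0) (zeroʳ a)))) ,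
    (λ k d<k → *-cancelˡ a≉0 (trans (sym (coeff-·ₚ a p k)) (trans (above≈0 k d<k) (sym (zeroʳ a)))))

  *ₚ-HasDegree : ∀ p q {j k} → HasDegree p j → HasDegree q k → HasDegree (p *ₚ q) (j ℕ.+ k)
  *ₚ-HasDegree p q {j} {k} (p-top , p-above) (q-top , q-above) =
    (λ top≈0 → *-≉0 p-top q-top (trans (sym (⋆-top j k p-above q-above)) (trans (sym (coeff-*ₚ p q (j ℕ.+ k))) top≈0))) ,
    (λ i j+k<i → trans (coeff-*ₚ p q i) (⋆-vanishesAbove j k p-above q-above i j+k<i))

  coeff-≥length : ∀ p {k} → length p ≤ k → coeff p k ≈ 0#
  coeff-≥length []      _         = refl
  coeff-≥length (a ∷ p) (s≤s p≤k) = coeff-≥length p p≤k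

  ¬¬-zero-or-HasDegree : ∀ p → ¬ ¬ (p ≋ [] ⊎ Σ ℕ (HasDegree p))
  ¬¬-zero-or-HasDegree []      k = k (inj₁ ≋-refl)
  ¬¬-zero-or-HasDegree (a ∷ p) k = ¬¬-zero-or-HasDegree p λ
    { (inj₂ (d , top≉0 , above≈0)) → k (inj₂ (suc d , top≉0 , λ { (suc i) (s≤s d<i) → above≈0 i d<i }))
    ; (inj₁ p≋[]) → ¬¬-excluded-middle λ
      { (yes a≈0) → k (inj₁ (coeffwise λ { zero → a≈0 ; (suc i) → get p≋[] i }))
      ; (no  a≉0) → k (inj₂ (0 , a≉0 , λ { (suc i) _ → get p≋[] i })) } }

  -- Classically p has some degree j, and then e = j + j.  The conclusions e ≡ m + m and
  -- coeff p m ≉ 0 are stable under double negation; the vanishing of p above m is not, and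
  -- comes from vanishesAbove-of-square.
  square-HasDegree : ¬ 1# + 1# ≈ 0# → ∀ p {e} → HasDegree (p *ₚ p) e → Σ ℕ λ m → e ≡ m ℕ.+ m × HasDegree p m
  square-HasDegree 2≉0 p {e} (p²-top , p²-above) = m , e≡m+m , top≉0 , above≈0
    where
    m = ⌊ e /2⌋

    half : p ≋ [] ⊎ Σ ℕ (HasDegree p) → e ≡ m ℕ.+ m × ¬ coeff p m ≈ 0#
    half (inj₁ p≋[])          = contradiction (get (*ₚ-cong p≋[] (≋-refl {p})) e) p²-top
    half (inj₂ (j , p-deg)) = ≡.subst (λ i → e ≡ i ℕ.+ i × ¬ coeff p i ≈ 0#) j≡m (e≡j+j , proj₁ p-deg)
      where
      e≡j+j : e ≡ j ℕ.+ j
      e≡j+j = HasDegree-unique (p *ₚ p) (p²-top , p²-above) (*ₚ-HasDegree p p p-deg p-deg)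
      j≡m : j ≡ m
      j≡m = ≡.trans (ℕ.n≡⌊n+n/2⌋ j) (≡.cong ⌊_/2⌋ (≡.sym e≡j+j))

    ¬¬-half : ¬ ¬ (e ≡ m ℕ.+ m × ¬ coeff p m ≈ 0#)
    ¬¬-half = ¬¬-map half (¬¬-zero-or-HasDegree p)

    e≡m+m : e ≡ m ℕ.+ m
    e≡m+m = decidable-stable (e ℕ.≟ m ℕ.+ m) (¬¬-map proj₁ ¬¬-half)

    top≉0 : ¬ coeff p m ≈ 0#
    top≉0 = negated-stable (¬¬-map proj₂ ¬¬-half)

    2top≉0 : ¬ (1# + 1#) * coeff p m ≈ 0#
    2top≉0 = *-≉0 2≉0 top≉0

    above≈0 : VanishesAbove m (coeff p)
    above≈0 = vanishesAbove-of-square (length p) commutativeRing (coeff p) (inv-r _ 2top≉0)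
      (λ j m+len<j → coeff-≥length p (ℕ.≤-trans (ℕ.m≤n+m (length p) m) (ℕ.<⇒≤ m+len<j)))
      (λ k m+m<k → trans (sym (coeff-*ₚ p p k)) (p²-above k (≡.subst (_< k) (≡.sym e≡m+m) m+m<k)))

  coeff-linear-*ₚ-zero : ∀ b a s → coeff ((b ∷ a ∷ []) *ₚ s) 0 ≈ b * coeff s 0
  coeff-linear-*ₚ-zero b a s = trans (coeff-+ₚ (b ·ₚ s) (0# ∷ ((a ∷ []) *ₚ s)) 0) (trans (+-identityʳ _) (coeff-·ₚ b s 0))

  coeff-linear-*ₚ-suc : ∀ b a s k → coeff ((b ∷ a ∷ []) *ₚ s) (suc k) ≈ b * coeff s (suc k) + a * coeff s k
  coeff-linear-*ₚ-suc b a s k =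
    trans (coeff-+ₚ (b ·ₚ s) (0# ∷ ((a ∷ []) *ₚ s)) (suc k))
          (+-cong (coeff-·ₚ b s (suc k)) (trans (get (≋-sym (·ₚ≋const-*ₚ a s)) k) (coeff-·ₚ a s k)))

  linear-*ₚ-vanishes⁻¹ : ∀ b s {d} → VanishesAbove d (coeff ((b ∷ 1# ∷ []) *ₚ s)) → ∀ k → d ≤ k → coeff s k ≈ 0#
  linear-*ₚ-vanishes⁻¹ b s {d} above≈0 k d≤k = downwards (length s) k d≤k (ℕ.m≤n+m (length s) k)
    where
    open import Relation.Binary.Reasoning.Setoid setoid
    downwards : ∀ t k → d ≤ k → length s ≤ k ℕ.+ t → coeff s k ≈ 0#
    downwards zero    k _   len≤k = coeff-≥length s (≡.subst (length s ≤_) (ℕ.+-identityʳ k) len≤k)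
    downwards (suc t) k d≤k len≤k = begin
      coeff s k                            ≈⟨ +-identityˡ _ ⟨
      0# + coeff s k                       ≈⟨ +-cong (trans (*-congˡ s[1+k]≈0) (zeroʳ b)) (*-identityˡ _) ⟨
      b * coeff s (suc k) + 1# * coeff s k ≈⟨ coeff-linear-*ₚ-suc b 1# s k ⟨
      coeff ((b ∷ 1# ∷ []) *ₚ s) (suc k)   ≈⟨ above≈0 (suc k) (s≤s d≤k) ⟩
      0#                                   ∎
      where
      s[1+k]≈0 = downwards t (suc k) (ℕ.m≤n⇒m≤1+n d≤k) (≡.subst (length s ≤_) (ℕ.+-suc k t) len≤k)

  linear-*ₚ-HasDegree⁻¹ : ∀ b s {d} → HasDegree ((b ∷ 1# ∷ []) *ₚ s) d → Σ ℕ λ d′ → d ≡ suc d′ × HasDegree s d′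
  linear-*ₚ-HasDegree⁻¹ b s {zero} (top≉0 , above≈0) =
    contradiction (trans (coeff-linear-*ₚ-zero b 1# s) (trans (*-congˡ (linear-*ₚ-vanishes⁻¹ b s above≈0 0 z≤n)) (zeroʳ b)))
                  top≉0
  linear-*ₚ-HasDegree⁻¹ b s {suc d} (top≉0 , above≈0) = d , ≡.refl , top′≉0 , linear-*ₚ-vanishes⁻¹ b s above≈0
    where
    open import Relation.Binary.Reasoning.Setoid setoid
    top′≉0 : ¬ coeff s d ≈ 0#
    top′≉0 s[d]≈0 = top≉0 (begin
      coeff ((b ∷ 1# ∷ []) *ₚ s) (suc d)   ≈⟨ coeff-linear-*ₚ-suc b 1# s d ⟩
      b * coeff s (suc d) + 1# * coeff s d ≈⟨ +-cong (trans (*-congˡ (linear-*ₚ-vanishes⁻¹ b s above≈0 (suc d) ℕ.≤-refl)) (zeroʳ b))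
                                                     (trans (*-identityˡ _) s[d]≈0) ⟩
      0# + 0#                              ≈⟨ +-identityʳ 0# ⟩
      0#                                   ∎)

module IndexArithmetic where
  open Binomial
  open +-*-Solver
  open ≡.≡-Reasoning

  2[1+k]∸1≡1+2k : ∀ k → 2 ℕ.* suc k ∸ 1 ≡ suc (k ℕ.+ k)
  2[1+k]∸1≡1+2k k = ≡.trans (≡.cong (λ j → k ℕ.+ suc j) (ℕ.+-identityʳ k)) (ℕ.+-suc k k)

  closed-form-ratio : ∀ k s → let m = suc k ℕ.+ s in
    2 ℕ.* (suc k ℕ.* suc (k ℕ.+ k) ℕ.* ((m ℕ.+ suc k) C (suc k ℕ.+ suc k)))
      ≡ suc s ℕ.* (m ℕ.+ suc k) ℕ.* ((m ℕ.+ k) C (k ℕ.+ k))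
  closed-form-ratio k s = begin
    2 ℕ.* (suc k ℕ.* suc (k ℕ.+ k) ℕ.* ((suc k ℕ.+ s ℕ.+ suc k) C (suc k ℕ.+ suc k)))
      ≡⟨ ≡.cong₂ (λ n j → 2 ℕ.* (suc k ℕ.* suc (k ℕ.+ k) ℕ.* (n C j))) m+1+k≡ (≡.cong suc (ℕ.+-suc k k)) ⟩
    2 ℕ.* (suc k ℕ.* suc (k ℕ.+ k) ℕ.* (suc (k ℕ.+ k ℕ.+ suc s) C suc (suc (k ℕ.+ k))))
      ≡⟨ solve 2 (λ k x → con 2 :* ((con 1 :+ k) :* (con 1 :+ (k :+ k)) :* x) := (con 2 :+ (k :+ k)) :* (con 1 :+ (k :+ k)) :* x)
               ≡.refl k (suc (k ℕ.+ k ℕ.+ suc s) C suc (suc (k ℕ.+ k))) ⟩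
    suc (suc (k ℕ.+ k)) ℕ.* suc (k ℕ.+ k) ℕ.* (suc (k ℕ.+ k ℕ.+ suc s) C suc (suc (k ℕ.+ k)))
      ≡⟨ [2+j]*[1+j]*[1+j+s]C[2+j]≡[1+j+s]*s*[j+s]Cj (k ℕ.+ k) (suc s) ⟩
    suc (k ℕ.+ k ℕ.+ suc s) ℕ.* suc s ℕ.* ((k ℕ.+ k ℕ.+ suc s) C (k ℕ.+ k))
      ≡⟨ ≡.cong₂ (λ a n → a ℕ.* (n C (k ℕ.+ k))) (ℕ.*-comm (suc s) (suc (k ℕ.+ k ℕ.+ suc s))) m+k≡ ⟨
    suc s ℕ.* suc (k ℕ.+ k ℕ.+ suc s) ℕ.* ((suc k ℕ.+ s ℕ.+ k) C (k ℕ.+ k))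
      ≡⟨ ≡.cong (λ n → suc s ℕ.* n ℕ.* ((suc k ℕ.+ s ℕ.+ k) C (k ℕ.+ k))) m+1+k≡ ⟨
    suc s ℕ.* (suc k ℕ.+ s ℕ.+ suc k) ℕ.* ((suc k ℕ.+ s ℕ.+ k) C (k ℕ.+ k))
      ∎
    where
    m+1+k≡ : suc k ℕ.+ s ℕ.+ suc k ≡ suc (k ℕ.+ k ℕ.+ suc s)
    m+1+k≡ = solve 2 (λ k s → con 1 :+ k :+ s :+ (con 1 :+ k) := con 1 :+ (k :+ k :+ (con 1 :+ s))) ≡.refl k s
    m+k≡ : suc k ℕ.+ s ℕ.+ k ≡ k ℕ.+ k ℕ.+ suc s
    m+k≡ = solve 2 (λ k s → con 1 :+ k :+ s :+ k := k :+ k :+ (con 1 :+ s)) ≡.refl k s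

  P-recurrence-binomials : ∀ m i →
    (suc (suc m) ℕ.+ suc i) C (suc i ℕ.+ suc i) ℕ.+ (m ℕ.+ suc i) C (suc i ℕ.+ suc i)
      ≡ (suc m ℕ.+ suc i) C (suc i ℕ.+ suc i) ℕ.+ (suc m ℕ.+ suc i) C (suc i ℕ.+ suc i) ℕ.+ (suc m ℕ.+ i) C (i ℕ.+ i)
  P-recurrence-binomials m i rewrite ℕ.+-suc m i | ℕ.+-suc i i =
    [2+n]C[2+k]+nC[2+k]≡2*[1+n]C[2+k]+nCk (suc (m ℕ.+ i)) (i ℕ.+ i)

  [1+i+r+e]∸i≡1+r+e : ∀ i r e → suc (i ℕ.+ r) ℕ.+ e ∸ i ≡ suc r ℕ.+ e
  [1+i+r+e]∸i≡1+r+e i r e =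
    ≡.trans (≡.cong (_∸ i) (solve 3 (λ i r e → con 1 :+ (i :+ r) :+ e := i :+ (con 1 :+ r :+ e)) ≡.refl i r e))
            (ℕ.m+n∸m≡n i (suc r ℕ.+ e))

  factor-split : ∀ i r e → let m = i ℕ.+ r; n = suc m ℕ.+ e in
    (n ∸ i ℕ.+ 1) ℕ.* (n ℕ.+ i) ≡ (m ∸ i ℕ.+ 1) ℕ.* (m ℕ.+ i) ℕ.+ (n ∸ suc m ℕ.+ 1) ℕ.* (n ℕ.+ suc m)
  factor-split i r e rewrite ℕ.m+n∸m≡n (suc (i ℕ.+ r)) e | ℕ.m+n∸m≡n i r | [1+i+r+e]∸i≡1+r+e i r e =
    solve 3 (λ i r e → (con 1 :+ r :+ e :+ con 1) :* (con 1 :+ i :+ r :+ e :+ i)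
                     := (r :+ con 1) :* (i :+ r :+ i) :+ (e :+ con 1) :* (con 1 :+ i :+ r :+ e :+ (con 1 :+ i :+ r)))
            ≡.refl i r e

module Coefficients {c ℓ : Level} (K : Field c ℓ) where
  open Field K hiding (zero)
  open FieldTheory K
  open FieldProperties K
  open import Algebra.Properties.Ring ring using (-‿injective; -0#≈0#)
  open import Algebra.Properties.Semiring.Mult semiring using (×-homo-+; ×1-homo-*) renaming (_×_ to _×ₙ_)
  open import Algebra.Properties.Semiring.Exp semiring using (_^_)
  open IntegerCoefficientSolver commutativeRing using (solve; _:+_; _:*_; :-_; _:=_; con)
  open IndexArithmetic
  open import Relation.Binary.Reasoning.Setoid setoid

  ι≡× : ∀ n → ι n ≡ n ×ₙ 1#
  ι≡× zero    = ≡.refl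
  ι≡× (suc n) = ≡.cong (λ x → 1# + x) (ι≡× n)

  ι-+ : ∀ m n → ι (m ℕ.+ n) ≈ ι m + ι n
  ι-+ m n rewrite ι≡× (m ℕ.+ n) | ι≡× m | ι≡× n = ×-homo-+ 1# m n

  ι-* : ∀ m n → ι (m ℕ.* n) ≈ ι m * ι n
  ι-* m n rewrite ι≡× (m ℕ.* n) | ι≡× m | ι≡× n = ×1-homo-* m n

  ι2≈1+1 : ι 2 ≈ 1# + 1#
  ι2≈1+1 = +-congˡ (+-identityʳ 1#)

  CharExceeds : ℕ → Set ℓ
  CharExceeds N = ∀ j → 0 < j → j ≤ N → ¬ ι j ≈ 0#

  Recurrence : Carrier → (ℕ → Carrier) → ℕ → Set ℓ
  Recurrence B a n = ∀ i → 1 ≤ i → i ≤ n →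
    ι i * ι (2 ℕ.* i ∸ 1) * B * a i ≈ - (ι 2 * ι (n ∸ i ℕ.+ 1) * ι (n ℕ.+ i) * a (i ∸ 1))

  ι-factor-split : ∀ i r e → let m = i ℕ.+ r; n = suc m ℕ.+ e in
    ι (n ∸ i ℕ.+ 1) * ι (n ℕ.+ i) ≈ ι (m ∸ i ℕ.+ 1) * ι (m ℕ.+ i) + ι (n ∸ suc m ℕ.+ 1) * ι (n ℕ.+ suc m)
  ι-factor-split i r e = begin
    ι (n ∸ i ℕ.+ 1) * ι (n ℕ.+ i)                   ≈⟨ ι-* (n ∸ i ℕ.+ 1) (n ℕ.+ i) ⟨
    ι ((n ∸ i ℕ.+ 1) ℕ.* (n ℕ.+ i))                 ≡⟨ ≡.cong ι (factor-split i r e) ⟩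
    ι ((m ∸ i ℕ.+ 1) ℕ.* (m ℕ.+ i) ℕ.+ (n ∸ suc m ℕ.+ 1) ℕ.* (n ℕ.+ suc m))
      ≈⟨ ι-+ ((m ∸ i ℕ.+ 1) ℕ.* (m ℕ.+ i)) ((n ∸ suc m ℕ.+ 1) ℕ.* (n ℕ.+ suc m)) ⟩
    ι ((m ∸ i ℕ.+ 1) ℕ.* (m ℕ.+ i)) + ι ((n ∸ suc m ℕ.+ 1) ℕ.* (n ℕ.+ suc m))
      ≈⟨ +-cong (ι-* (m ∸ i ℕ.+ 1) (m ℕ.+ i)) (ι-* (n ∸ suc m ℕ.+ 1) (n ℕ.+ suc m)) ⟩
    ι (m ∸ i ℕ.+ 1) * ι (m ℕ.+ i) + ι (n ∸ suc m ℕ.+ 1) * ι (n ℕ.+ suc m) ∎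
    where
    m = i ℕ.+ r
    n = suc m ℕ.+ e

  -- When a (m + 1) vanishes, the recurrence at i = m + 1 forces (n − m)(n + m + 1) = 0 in K,
  -- and then the factors (n − i + 1)(n + i) and (m − i + 1)(m + i) agree.
  Recurrence-restrict : ∀ {B a m n} → ¬ ι 2 ≈ 0# → ¬ a m ≈ 0# → m < n → a (suc m) ≈ 0# →
                        Recurrence B a n → Recurrence B a m
  Recurrence-restrict {B} {a} {m} {n} ι2≉0 am≉0 m<n a[1+m]≈0 rec i 1≤i i≤m
    with ℕ.m≤n⇒∃[o]m+o≡n i≤m | ℕ.m≤n⇒∃[o]m+o≡n m<n
  ... | r , ≡.refl | e , ≡.refl =
    trans (rec i 1≤i (ℕ.≤-trans i≤m (ℕ.<⇒≤ m<n))) (-‿cong (*-congʳ factors))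
    where
    u = ι (n ∸ suc m ℕ.+ 1)
    v = ι (n ℕ.+ suc m)

    uv≈0 : u * v ≈ 0#
    uv≈0 = *-cancelˡ (*-≉0 ι2≉0 am≉0) (begin
      (ι 2 * a m) * (u * v)           ≈⟨ solve 4 (λ t z x y → (t :* z) :* (x :* y) := t :* x :* y :* z) refl (ι 2) (a m) u v ⟩
      ι 2 * u * v * a m               ≈⟨ -‿injective (trans (sym (rec (suc m) (s≤s z≤n) m<n))
                                                             (trans (*-congˡ a[1+m]≈0) (trans (zeroʳ _) (sym -0#≈0#)))) ⟩
      0#                              ≈⟨ zeroʳ _ ⟨
      (ι 2 * a m) * 0#                ∎)

    factors : ι 2 * ι (n ∸ i ℕ.+ 1) * ι (n ℕ.+ i) ≈ ι 2 * ι (m ∸ i ℕ.+ 1) * ι (m ℕ.+ i)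
    factors = begin
      ι 2 * ι (n ∸ i ℕ.+ 1) * ι (n ℕ.+ i)                  ≈⟨ *-assoc _ _ _ ⟩
      ι 2 * (ι (n ∸ i ℕ.+ 1) * ι (n ℕ.+ i))                ≈⟨ *-congˡ (ι-factor-split i r e) ⟩
      ι 2 * (ι (m ∸ i ℕ.+ 1) * ι (m ℕ.+ i) + u * v)        ≈⟨ *-congˡ (trans (+-congˡ uv≈0) (+-identityʳ _)) ⟩
      ι 2 * (ι (m ∸ i ℕ.+ 1) * ι (m ℕ.+ i))                ≈⟨ *-assoc _ _ _ ⟨
      ι 2 * ι (m ∸ i ℕ.+ 1) * ι (m ℕ.+ i)                  ∎

  closedFormCoeff : ℕ → ℕ → Carrier
  closedFormCoeff m k = (- (1# + 1# + 1# + 1#)) ^ k * ι ((m ℕ.+ k) C (k ℕ.+ k))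

  -- Induction on k: the recurrence at i = k + 1, times Bᵏ, and the binomial ratio
  -- 2 (k + 1)(2k + 1) C(m + k + 1, 2k + 2) = (m − k)(m + k + 1) C(m + k, 2k) agree after
  -- cancelling the nonzero factor (k + 1)(2k + 1).
  Recurrence⇒closed-form : ∀ {B a m} → CharExceeds (m ℕ.+ m) → Recurrence B a m →
                            ∀ k → k ≤ m → B ^ k * a k ≈ a 0 * closedFormCoeff m k
  Recurrence⇒closed-form {B} {a} {m} char rec zero _ =
    solve 1 (λ x → con (+ 1) :* x := x :* (con (+ 1) :* (con (+ 1) :+ con (+ 0)))) refl (a 0)
  Recurrence⇒closed-form {B} {a} {m} char rec (suc k) 1+k≤m with ℕ.m≤n⇒∃[o]m+o≡n 1+k≤m
  ... | s , ≡.refl = *-cancelˡ (*-≉0 N₁≉0 N₂≉0) (trans lhs (sym rhs))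
    where
    σ  = (- (1# + 1# + 1# + 1#)) ^ k
    N₁ = ι (suc k)
    N₂ = ι (suc (k ℕ.+ k))
    M₁ = ι (suc s)
    M₂ = ι (m ℕ.+ suc k)
    c₁ = (m ℕ.+ suc k) C (suc k ℕ.+ suc k)
    c₀ = (m ℕ.+ k) C (k ℕ.+ k)
    C₁ = ι c₁
    C₀ = ι c₀

    N₁≉0 : ¬ N₁ ≈ 0#
    N₁≉0 = char (suc k) (s≤s z≤n) (ℕ.≤-trans 1+k≤m (ℕ.m≤m+n m m))
    N₂≉0 : ¬ N₂ ≈ 0#
    N₂≉0 = char (suc (k ℕ.+ k)) (s≤s z≤n) (ℕ.+-mono-≤ 1+k≤m (ℕ.≤-trans (ℕ.n≤1+n k) 1+k≤m))

    recurrence : N₁ * N₂ * B * a (suc k) ≈ - ((1# + 1#) * M₁ * M₂ * a k)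
    recurrence = begin
      N₁ * N₂ * B * a (suc k)                       ≡⟨ ≡.cong (λ j → N₁ * ι j * B * a (suc k)) (2[1+k]∸1≡1+2k k) ⟨
      ι (suc k) * ι (2 ℕ.* suc k ∸ 1) * B * a (suc k) ≈⟨ rec (suc k) (s≤s z≤n) 1+k≤m ⟩
      - (ι 2 * ι (m ∸ suc k ℕ.+ 1) * M₂ * a k)      ≡⟨ ≡.cong (λ j → - (ι 2 * ι j * M₂ * a k)) m∸[1+k]+1≡1+s ⟩
      - (ι 2 * M₁ * M₂ * a k)                       ≈⟨ -‿cong (*-congʳ (*-congʳ (*-congʳ ι2≈1+1))) ⟩
      - ((1# + 1#) * M₁ * M₂ * a k)                 ∎
      where
      m∸[1+k]+1≡1+s : m ∸ suc k ℕ.+ 1 ≡ suc s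
      m∸[1+k]+1≡1+s = ≡.trans (≡.cong (ℕ._+ 1) (ℕ.m+n∸m≡n (suc k) s)) (ℕ.+-comm s 1)

    ratio : (1# + 1#) * (N₁ * N₂ * C₁) ≈ M₁ * M₂ * C₀
    ratio = begin
      (1# + 1#) * (N₁ * N₂ * C₁)                       ≈⟨ *-cong ι2≈1+1 (*-congʳ (ι-* (suc k) (suc (k ℕ.+ k)))) ⟨
      ι 2 * (ι (suc k ℕ.* suc (k ℕ.+ k)) * ι c₁)       ≈⟨ *-congˡ (ι-* (suc k ℕ.* suc (k ℕ.+ k)) c₁) ⟨
      ι 2 * ι (suc k ℕ.* suc (k ℕ.+ k) ℕ.* c₁)         ≈⟨ ι-* 2 (suc k ℕ.* suc (k ℕ.+ k) ℕ.* c₁) ⟨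
      ι (2 ℕ.* (suc k ℕ.* suc (k ℕ.+ k) ℕ.* c₁))       ≡⟨ ≡.cong ι (closed-form-ratio k s) ⟩
      ι (suc s ℕ.* (m ℕ.+ suc k) ℕ.* c₀)               ≈⟨ trans (ι-* (suc s ℕ.* (m ℕ.+ suc k)) c₀) (*-congʳ (ι-* (suc s) (m ℕ.+ suc k))) ⟩
      M₁ * M₂ * C₀                                     ∎

    lhs : (N₁ * N₂) * (B ^ suc k * a (suc k)) ≈ - ((1# + 1#) * M₁ * M₂) * (a 0 * (σ * C₀))
    lhs = begin
      (N₁ * N₂) * (B * B ^ k * a (suc k))
        ≈⟨ solve 5 (λ n₁ n₂ b p x → (n₁ :* n₂) :* (b :* p :* x) := p :* (n₁ :* n₂ :* b :* x))
                 refl N₁ N₂ B (B ^ k) (a (suc k)) ⟩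
      B ^ k * (N₁ * N₂ * B * a (suc k))             ≈⟨ *-congˡ recurrence ⟩
      B ^ k * - ((1# + 1#) * M₁ * M₂ * a k)
        ≈⟨ solve 4 (λ p m₁ m₂ x → p :* (:- (con (+ 2) :* m₁ :* m₂ :* x)) := (:- (con (+ 2) :* m₁ :* m₂)) :* (p :* x))
                 refl (B ^ k) M₁ M₂ (a k) ⟩
      - ((1# + 1#) * M₁ * M₂) * (B ^ k * a k)       ≈⟨ *-congˡ (Recurrence⇒closed-form char rec k (ℕ.<⇒≤ 1+k≤m)) ⟩
      - ((1# + 1#) * M₁ * M₂) * (a 0 * (σ * C₀))    ∎

    rhs : (N₁ * N₂) * (a 0 * closedFormCoeff m (suc k)) ≈ - ((1# + 1#) * M₁ * M₂) * (a 0 * (σ * C₀))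
    rhs = begin
      (N₁ * N₂) * (a 0 * (- (1# + 1# + 1# + 1#) * σ * C₁))
        ≈⟨ solve 5 (λ n₁ n₂ x s c₁ → (n₁ :* n₂) :* (x :* ((:- con (+ 4)) :* s :* c₁))
                                  := (:- (con (+ 2) :* x :* s)) :* (con (+ 2) :* (n₁ :* n₂ :* c₁))) refl N₁ N₂ (a 0) σ C₁ ⟩
      - ((1# + 1#) * a 0 * σ) * ((1# + 1#) * (N₁ * N₂ * C₁))
        ≈⟨ *-congˡ ratio ⟩
      - ((1# + 1#) * a 0 * σ) * (M₁ * M₂ * C₀)
        ≈⟨ solve 5 (λ x s m₁ m₂ c₀ → (:- (con (+ 2) :* x :* s)) :* (m₁ :* m₂ :* c₀)
                                  := (:- (con (+ 2) :* m₁ :* m₂)) :* (x :* (s :* c₀)))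
                 refl (a 0) σ M₁ M₂ C₀ ⟩
      - ((1# + 1#) * M₁ * M₂) * (a 0 * (σ * C₀))    ∎

module ChebyshevPolynomials {c ℓ : Level} (K : Field c ℓ) where
  open Field K hiding (zero)
  open FieldTheory K
  open PolynomialRing K
  open Degrees K using (coeff-linear-*ₚ-zero; coeff-linear-*ₚ-suc)
  open Coefficients K
  open IndexArithmetic using (P-recurrence-binomials)
  open IntegerCoefficientSolver commutativeRing using (solve; _:+_; _:*_; :-_; _:=_; con)
  open import Algebra.Properties.Semiring.Exp semiring using (_^_)
  open IntegerCoefficientSolver polynomialRing using ()
    renaming (solve to solveₚ; _:+_ to _⊕_; _:*_ to _⊛_; :-_ to ⊝_; _:=_ to _≐_; con to κ)

  -- For a solution a of the recurrence, g (B x) = a 0 · P m x (dilate≋P); and P m ((1 + y) / 2)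
  -- is (-1)ᵐ Wₘ(y), with Wₘ the Chebyshev polynomials of the fourth kind.
  P : ℕ → Poly
  P m = polyOf (closedFormCoeff m) m

  coeff-P : ∀ m k → coeff (P m) k ≈ closedFormCoeff m k
  coeff-P m k with k ℕ.≤? m
  ... | yes k≤m = reflexive (coeff-polyOf (closedFormCoeff m) k≤m)
  ... | no  k≰m = begin
    coeff (P m) k       ≡⟨ polyOf-vanishesAbove (closedFormCoeff m) (ℕ.≰⇒> k≰m) ⟩
    0#                  ≈⟨ zeroʳ _ ⟨
    _ * 0#              ≡⟨ ≡.cong (λ n → _ * ι n) (k>n⇒nCk≡0 (ℕ.+-monoˡ-< k (ℕ.≰⇒> k≰m))) ⟨
    closedFormCoeff m k ∎
    where open import Relation.Binary.Reasoning.Setoid setoid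

  P-rec : ∀ m → P (suc (suc m)) ≋ (((1# + 1#) ∷ (- (1# + 1# + 1# + 1#)) ∷ []) *ₚ P (suc m)) +ₚ (-ₚ P m)
  P-rec m = coeffwise λ k →
    trans (coeff-P (suc (suc m)) k)
          (sym (trans (coeff-+ₚ (L *ₚ P (suc m)) (-ₚ P m) k) (trans (+-congˡ (coeff--ₚ (P m) k)) (coefficient k))))
    where
    open import Relation.Binary.Reasoning.Setoid setoid
    four = 1# + 1# + 1# + 1#
    L = (1# + 1#) ∷ (- four) ∷ []

    coefficient : ∀ k → coeff (L *ₚ P (suc m)) k - coeff (P m) k ≈ closedFormCoeff (suc (suc m)) k
    coefficient zero = begin
      coeff (L *ₚ P (suc m)) 0 - coeff (P m) 0
        ≈⟨ +-cong (trans (coeff-linear-*ₚ-zero (1# + 1#) (- four) (P (suc m))) (*-congˡ (coeff-P (suc m) 0))) (-‿cong (coeff-P m 0)) ⟩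
      (1# + 1#) * closedFormCoeff (suc m) 0 - closedFormCoeff m 0
        ≈⟨ solve 0 (con (+ 2) :* (con (+ 1) :* (con (+ 1) :+ con (+ 0))) :+ :- (con (+ 1) :* (con (+ 1) :+ con (+ 0)))
                    := con (+ 1) :* (con (+ 1) :+ con (+ 0))) refl ⟩
      closedFormCoeff (suc (suc m)) 0 ∎
    coefficient (suc i) = begin
      coeff (L *ₚ P (suc m)) (suc i) - coeff (P m) (suc i)
        ≈⟨ +-cong (trans (coeff-linear-*ₚ-suc (1# + 1#) (- four) (P (suc m)) i)
                         (+-cong (*-congˡ (coeff-P (suc m) (suc i))) (*-congˡ (coeff-P (suc m) i))))
                  (-‿cong (coeff-P m (suc i))) ⟩
      (1# + 1#) * (- four * σ * x₂) + - four * (σ * x₃) - - four * σ * x₄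
        ≈⟨ solve 4 (λ s a b c → con (+ 2) :* (:- con (+ 4) :* s :* a) :+ :- con (+ 4) :* (s :* b) :+ :- (:- con (+ 4) :* s :* c)
                              := :- con (+ 4) :* s :* ((a :+ a :+ b) :+ :- c)) refl σ x₂ x₃ x₄ ⟩
      - four * σ * ((x₂ + x₂ + x₃) - x₄)
        ≈⟨ *-congˡ x₁≈ ⟨
      closedFormCoeff (suc (suc m)) (suc i) ∎
      where
      σ  = (- four) ^ i
      b₁ = (suc (suc m) ℕ.+ suc i) C (suc i ℕ.+ suc i)
      b₂ = (suc m ℕ.+ suc i) C (suc i ℕ.+ suc i)
      b₃ = (suc m ℕ.+ i) C (i ℕ.+ i)
      b₄ = (m ℕ.+ suc i) C (suc i ℕ.+ suc i)
      x₁ = ι b₁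
      x₂ = ι b₂
      x₃ = ι b₃
      x₄ = ι b₄
      x₁≈ : x₁ ≈ (x₂ + x₂ + x₃) - x₄
      x₁≈ = begin
        x₁                        ≈⟨ solve 2 (λ x y → x := (x :+ y) :+ :- y) refl x₁ x₄ ⟩
        (x₁ + x₄) - x₄            ≈⟨ +-congʳ (ι-+ b₁ b₄) ⟨
        ι (b₁ ℕ.+ b₄) - x₄        ≡⟨ ≡.cong (λ n → ι n - x₄) (P-recurrence-binomials m i) ⟩
        ι (b₂ ℕ.+ b₂ ℕ.+ b₃) - x₄ ≈⟨ +-congʳ (trans (ι-+ (b₂ ℕ.+ b₂) b₃) (+-congʳ (ι-+ b₂ b₂))) ⟩
        (x₂ + x₂ + x₃) - x₄       ∎

  dilate : Carrier → Poly → Poly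
  dilate b []      = []
  dilate b (a ∷ p) = a ∷ (b ·ₚ dilate b p)

  coeff-dilate : ∀ b p k → coeff (dilate b p) k ≈ b ^ k * coeff p k
  coeff-dilate b []      k       = sym (zeroʳ _)
  coeff-dilate b (a ∷ p) zero    = sym (*-identityˡ a)
  coeff-dilate b (a ∷ p) (suc k) =
    trans (coeff-·ₚ b (dilate b p) k) (trans (*-congˡ (coeff-dilate b p k)) (sym (*-assoc _ _ _)))

  ∘ₚ-dilate : ∀ b p q → p ∘ₚ (const b *ₚ q) ≋ dilate b p ∘ₚ q
  ∘ₚ-dilate b []      q = ≋-refl
  ∘ₚ-dilate b (a ∷ p) q =
    ≋-trans (+ₚ-congˡ (const a) (*ₚ-congˡ (const b *ₚ q) (∘ₚ-dilate b p q)))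
      (≋-trans (solveₚ 4 (λ A B Q D → A ⊕ (B ⊛ Q) ⊛ D ≐ A ⊕ Q ⊛ (B ⊛ D)) ≋-refl (const a) (const b) q (dilate b p ∘ₚ q))
               (+ₚ-congˡ (const a) (*ₚ-congˡ q (≋-sym (·ₚ-∘ₚ b (dilate b p) q)))))

  T-rec : ∀ k → T (suc (suc k)) ≋ ((X +ₚ X) *ₚ T (suc k)) +ₚ (-ₚ T k)
  T-rec k = +ₚ-congʳ (-ₚ T k)
    (≋-trans (·ₚ≋const-*ₚ (ι 2) (X *ₚ T (suc k)))
      (≋-trans (*ₚ-congʳ (X *ₚ T (suc k)) (∷-cong ι2≈1+1 (≋-refl {[]})))
               (solveₚ 2 (λ Y S → κ (+ 2) ⊛ (Y ⊛ S) ≐ (Y ⊕ Y) ⊛ S) ≋-refl X (T (suc k)))))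

  module HalfShift (h : Carrier) (2h≈1 : (1# + 1#) * h ≈ 1#) where
    open import Relation.Binary.Reasoning.Setoid (CommutativeRing.setoid polynomialRing)

    Z : Poly
    Z = h ∷ h ∷ []

    Z≋h[1+X] : Z ≋ const h *ₚ (const 1# +ₚ X)
    Z≋h[1+X] = coeffwise λ
      { zero          → sym (trans (+-identityʳ _) (trans (*-congˡ (+-identityʳ 1#)) (*-identityʳ h)))
      ; (suc zero)    → sym (*-identityʳ h)
      ; (suc (suc k)) → refl }

    2·h≋1 : const (1# + 1#) *ₚ const h ≋ const 1#
    2·h≋1 = ≋-trans (const-*ₚ (1# + 1#) h) (∷-cong 2h≈1 ≋-refl)

    r : ℕ → Poly
    r m = P m ∘ₚ Z

    Z*-4≋-2-2X : Z *ₚ (-ₚ const (1# + 1# + 1# + 1#)) ≋ -ₚ (const (1# + 1#) +ₚ (X +ₚ X))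
    Z*-4≋-2-2X = begin
      Z *ₚ (-ₚ const (1# + 1# + 1# + 1#))
        ≈⟨ *ₚ-congʳ (-ₚ const (1# + 1# + 1# + 1#)) Z≋h[1+X] ⟩
      (const h *ₚ (const 1# +ₚ X)) *ₚ (-ₚ const (1# + 1# + 1# + 1#))
        ≈⟨ solveₚ 2 (λ H Y → (H ⊛ (κ (+ 1) ⊕ Y)) ⊛ (⊝ κ (+ 4)) ≐ ⊝ ((κ (+ 2) ⊛ (κ (+ 2) ⊛ H)) ⊛ (κ (+ 1) ⊕ Y)))
                   ≋-refl (const h) X ⟩
      -ₚ ((const (1# + 1#) *ₚ (const (1# + 1#) *ₚ const h)) *ₚ (const 1# +ₚ X))
        ≈⟨ -ₚ-cong (*ₚ-congʳ (const 1# +ₚ X) (*ₚ-congˡ (const (1# + 1#)) 2·h≋1)) ⟩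
      -ₚ ((const (1# + 1#) *ₚ const 1#) *ₚ (const 1# +ₚ X))
        ≈⟨ solveₚ 1 (λ Y → ⊝ ((κ (+ 2) ⊛ κ (+ 1)) ⊛ (κ (+ 1) ⊕ Y)) ≐ ⊝ (κ (+ 2) ⊕ (Y ⊕ Y))) ≋-refl X ⟩
      -ₚ (const (1# + 1#) +ₚ (X +ₚ X))
        ∎

    r-rec : ∀ m → r (suc (suc m)) ≋ ((-ₚ (X +ₚ X)) *ₚ r (suc m)) +ₚ (-ₚ r m)
    r-rec m = begin
      r (suc (suc m))                            ≈⟨ ∘ₚ-congˡ Z (P-rec m) ⟩
      ((L *ₚ P (suc m)) +ₚ (-ₚ P m)) ∘ₚ Z        ≈⟨ ∘ₚ-homo-+ₚ (L *ₚ P (suc m)) (-ₚ P m) Z ⟩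
      ((L *ₚ P (suc m)) ∘ₚ Z) +ₚ ((-ₚ P m) ∘ₚ Z) ≈⟨ +ₚ-cong (∘ₚ-homo-*ₚ L (P (suc m)) Z) (∘ₚ-homo--ₚ (P m) Z) ⟩
      ((L ∘ₚ Z) *ₚ r (suc m)) +ₚ (-ₚ r m)        ≈⟨ +ₚ-congʳ (-ₚ r m) (*ₚ-congʳ (r (suc m)) L∘Z) ⟩
      ((-ₚ (X +ₚ X)) *ₚ r (suc m)) +ₚ (-ₚ r m)   ∎
      where
      L = (1# + 1#) ∷ (- (1# + 1# + 1# + 1#)) ∷ []
      L∘Z : L ∘ₚ Z ≋ -ₚ (X +ₚ X)
      L∘Z = begin
        L ∘ₚ Z                                                ≈⟨ +ₚ-congˡ (const (1# + 1#)) (*ₚ-congˡ Z (const-∘ₚ _ Z)) ⟩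
        const (1# + 1#) +ₚ Z *ₚ (-ₚ const (1# + 1# + 1# + 1#)) ≈⟨ +ₚ-congˡ (const (1# + 1#)) Z*-4≋-2-2X ⟩
        const (1# + 1#) +ₚ (-ₚ (const (1# + 1#) +ₚ (X +ₚ X)))  ≈⟨ solveₚ 1 (λ Y → κ (+ 2) ⊕ ⊝ (κ (+ 2) ⊕ (Y ⊕ Y)) ≐ ⊝ (Y ⊕ Y))
                                                                        ≋-refl X ⟩
        -ₚ (X +ₚ X)                                           ∎

    r₀ : r 0 ≋ const 1#
    r₀ = ≋-trans (const-∘ₚ (closedFormCoeff 0 0) Z) (∷-cong (trans (*-identityˡ _) (+-identityʳ 1#)) (≋-refl {[]}))

    r₁ : r 1 ≋ (-ₚ (X +ₚ X)) +ₚ (-ₚ const 1#)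
    r₁ = begin
      r 1                                                ≈⟨ +ₚ-cong (∷-cong c₀≈1 (≋-refl {[]})) (*ₚ-congˡ Z (≋-trans (const-∘ₚ _ Z) c₁≋-4)) ⟩
      const 1# +ₚ Z *ₚ (-ₚ const (1# + 1# + 1# + 1#))     ≈⟨ +ₚ-congˡ (const 1#) Z*-4≋-2-2X ⟩
      const 1# +ₚ (-ₚ (const (1# + 1#) +ₚ (X +ₚ X)))      ≈⟨ solveₚ 1 (λ Y → κ (+ 1) ⊕ ⊝ (κ (+ 2) ⊕ (Y ⊕ Y)) ≐ (⊝ (Y ⊕ Y)) ⊕ (⊝ κ (+ 1)))
                                                                     ≋-refl X ⟩
      (-ₚ (X +ₚ X)) +ₚ (-ₚ const 1#)                     ∎
      where
      c₀≈1 : closedFormCoeff 1 0 ≈ 1#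
      c₀≈1 = trans (*-identityˡ _) (+-identityʳ 1#)
      c₁≋-4 : const (closedFormCoeff 1 1) ≋ -ₚ const (1# + 1# + 1# + 1#)
      c₁≋-4 = ∷-cong (trans (*-cong (*-identityʳ _) (+-identityʳ 1#)) (*-identityʳ _)) (≋-refl {[]})

    1-X*r²≋1-T : ∀ m → (const 1# +ₚ (-ₚ X)) *ₚ (r m *ₚ r m) ≋ const 1# +ₚ (-ₚ T (suc (m ℕ.+ m)))
    1-X*r²≋1-T =
      ChebyshevIdentity.1-y*r²≈1-t[2m+1] polynomialRing X {T} {r} (≋-refl {const 1#}) (≋-refl {X}) T-rec r₀ r₁ r-rec

module Conjugation {c ℓ : Level} (K : Field c ℓ) where
  open Field K hiding (zero)
  open FieldTheory K
  open FieldProperties K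
  open PolynomialRing K
  open ChebyshevPolynomials K
  open IntegerCoefficientSolver commutativeRing using (solve; _:+_; _:*_; :-_; _:=_; con)
  open IntegerCoefficientSolver polynomialRing using ()
    renaming (solve to solveₚ; _:+_ to _⊕_; _:*_ to _⊛_; :-_ to ⊝_; _:=_ to _≐_; con to κ)
  open import Relation.Binary.Reasoning.Setoid (CommutativeRing.setoid polynomialRing)

  conjugate-by : ∀ {f g} u v w → u * w ≈ 1# → g ≋ (v ∷ u ∷ []) ∘ₚ (f ∘ₚ ((- (w * v)) ∷ w ∷ [])) → Conjugate f g
  conjugate-by {f} {g} u v w uw≈1 g≋ = u , u≉0 , v , get (≋-trans g≋ (∘ₚ-congʳ (v ∷ u ∷ []) (∘ₚ-congʳ f γ⁻¹≋)))
    where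
    u≉0 : ¬ u ≈ 0#
    u≉0 u≈0 = 1≉0 (trans (sym uw≈1) (trans (*-congʳ u≈0) (zeroˡ w)))
    inv≈w : inv u u≉0 ≈ w
    inv≈w = *-cancelˡ u≉0 (trans (inv-r u u≉0) (sym uw≈1))
    γ⁻¹≋ : (- (w * v)) ∷ w ∷ [] ≋ (- (inv u u≉0 * v)) ∷ inv u u≉0 ∷ []
    γ⁻¹≋ = ∷-cong (-‿cong (*-congʳ (sym inv≈w))) (∷-cong (sym inv≈w) (≋-refl {[]}))

  linear-∘ₚ : ∀ v u p → (v ∷ u ∷ []) ∘ₚ p ≋ const v +ₚ p *ₚ const u
  linear-∘ₚ v u p = +ₚ-congˡ (const v) (*ₚ-congˡ p (const-∘ₚ u p))

  module _ {A B a₀ : Carrier} (Aa₀²≈-1 : A * (a₀ * a₀) ≈ - 1#) {h : Carrier} (2h≈1 : (1# + 1#) * h ≈ 1#) where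
    open HalfShift h 2h≈1 using (Z; Z≋h[1+X]; 2·h≋1; r; 1-X*r²≋1-T)

    private
      L = (- B) ∷ 1# ∷ []

      Aa₀²≋-1 : const A *ₚ (const a₀ *ₚ const a₀) ≋ -ₚ const 1#
      Aa₀²≋-1 = ≋-trans (*ₚ-congˡ (const A) (const-*ₚ a₀ a₀))
                        (≋-trans (const-*ₚ A (a₀ * a₀)) (∷-cong Aa₀²≈-1 (≋-refl {[]})))

    -- γ x = 2x / B − 1, so that γ⁻¹ y = B (1 + y) / 2 and f (γ⁻¹ y) = (B / 2) (1 − y) (r m y)².
    conjugate-odd : ∀ {f} → ¬ B ≈ 0# → ∀ m G → dilate B G ≋ a₀ ·ₚ P m → f ≋ (A ·ₚ L) *ₚ (G *ₚ G) →
                    Conjugate f (-ₚ T (suc (m ℕ.+ m)))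
    conjugate-odd {f} B≉0 m G dilate≋ f≋ = conjugate-by {f} u (- 1#) (B * h) uw≈1 (≋-sym γfγ⁻¹≋-T)
      where
      u = (1# + 1#) * inv B B≉0
      uw≈1 : u * (B * h) ≈ 1#
      uw≈1 = trans (solve 4 (λ t i b h → (t :* i) :* (b :* h) := (t :* h) :* (b :* i)) refl (1# + 1#) (inv B B≉0) B h)
                   (trans (*-cong 2h≈1 (inv-r B B≉0)) (*-identityʳ 1#))

      Y = const B *ₚ Z
      γ⁻¹≋Y : (- ((B * h) * - 1#)) ∷ (B * h) ∷ [] ≋ Y
      γ⁻¹≋Y = ∷-cong (solve 2 (λ b h → :- ((b :* h) :* (:- con (+ 1))) := b :* h :+ con (+ 0)) refl B h) ≋-refl

      G∘Y : G ∘ₚ Y ≋ const a₀ *ₚ r m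
      G∘Y = ≋-trans (∘ₚ-dilate B G Z) (≋-trans (∘ₚ-congˡ Z dilate≋) (·ₚ-∘ₚ a₀ (P m) Z))

      f∘Y : f ∘ₚ Y ≋ const (B * h) *ₚ (const 1# +ₚ (-ₚ T (suc (m ℕ.+ m))))
      f∘Y = begin
        f ∘ₚ Y
          ≈⟨ ∘ₚ-congˡ Y f≋ ⟩
        ((A ·ₚ L) *ₚ (G *ₚ G)) ∘ₚ Y
          ≈⟨ ≋-trans (∘ₚ-homo-*ₚ (A ·ₚ L) (G *ₚ G) Y) (*ₚ-cong (·ₚ-∘ₚ A L Y) (∘ₚ-homo-*ₚ G G Y)) ⟩
        (const A *ₚ (L ∘ₚ Y)) *ₚ ((G ∘ₚ Y) *ₚ (G ∘ₚ Y))
          ≈⟨ *ₚ-cong (*ₚ-congˡ (const A) L∘Y) (*ₚ-cong G∘Y G∘Y) ⟩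
        (const A *ₚ (-ₚ const B +ₚ (const B *ₚ (const h *ₚ (const 1# +ₚ X))) *ₚ const 1#))
          *ₚ ((const a₀ *ₚ r m) *ₚ (const a₀ *ₚ r m))
          ≈⟨ solveₚ 6 (λ A′ B′ H a R Y′ → (A′ ⊛ ((⊝ B′) ⊕ (B′ ⊛ (H ⊛ (κ (+ 1) ⊕ Y′))) ⊛ κ (+ 1))) ⊛ ((a ⊛ R) ⊛ (a ⊛ R))
                                        ≐ (A′ ⊛ (a ⊛ a)) ⊛ (B′ ⊛ (H ⊛ (Y′ ⊕ ⊝ κ (+ 1)) ⊕ (κ (+ 2) ⊛ H ⊕ ⊝ κ (+ 1))) ⊛ (R ⊛ R)))
                    ≋-refl (const A) (const B) (const h) (const a₀) (r m) X ⟩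
        (const A *ₚ (const a₀ *ₚ const a₀))
          *ₚ (const B *ₚ (const h *ₚ (X +ₚ (-ₚ const 1#)) +ₚ (const (1# + 1#) *ₚ const h +ₚ (-ₚ const 1#))) *ₚ (r m *ₚ r m))
          ≈⟨ *ₚ-cong Aa₀²≋-1 (*ₚ-congʳ (r m *ₚ r m) (*ₚ-congˡ (const B) (+ₚ-congˡ (const h *ₚ (X +ₚ (-ₚ const 1#)))
                                                                              (+ₚ-congʳ (-ₚ const 1#) 2·h≋1)))) ⟩
        (-ₚ const 1#) *ₚ (const B *ₚ (const h *ₚ (X +ₚ (-ₚ const 1#)) +ₚ (const 1# +ₚ (-ₚ const 1#))) *ₚ (r m *ₚ r m))
          ≈⟨ solveₚ 4 (λ B′ H Y′ R → (⊝ κ (+ 1)) ⊛ (B′ ⊛ (H ⊛ (Y′ ⊕ ⊝ κ (+ 1)) ⊕ (κ (+ 1) ⊕ ⊝ κ (+ 1))) ⊛ (R ⊛ R))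
                                 ≐ (B′ ⊛ H) ⊛ ((κ (+ 1) ⊕ ⊝ Y′) ⊛ (R ⊛ R)))
                    ≋-refl (const B) (const h) X (r m) ⟩
        (const B *ₚ const h) *ₚ ((const 1# +ₚ (-ₚ X)) *ₚ (r m *ₚ r m))
          ≈⟨ *ₚ-cong (const-*ₚ B h) (1-X*r²≋1-T m) ⟩
        const (B * h) *ₚ (const 1# +ₚ (-ₚ T (suc (m ℕ.+ m))))
          ∎
        where
        L∘Y : L ∘ₚ Y ≋ -ₚ const B +ₚ (const B *ₚ (const h *ₚ (const 1# +ₚ X))) *ₚ const 1#
        L∘Y = ≋-trans (linear-∘ₚ (- B) 1# Y) (+ₚ-congˡ (const (- B)) (*ₚ-congʳ (const 1#) (*ₚ-congˡ (const B) Z≋h[1+X])))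

      γfγ⁻¹≋-T : (- 1# ∷ u ∷ []) ∘ₚ (f ∘ₚ ((- ((B * h) * - 1#)) ∷ (B * h) ∷ [])) ≋ -ₚ T (suc (m ℕ.+ m))
      γfγ⁻¹≋-T = begin
        (- 1# ∷ u ∷ []) ∘ₚ (f ∘ₚ ((- ((B * h) * - 1#)) ∷ (B * h) ∷ []))
          ≈⟨ ≋-trans (linear-∘ₚ (- 1#) u (f ∘ₚ ((- ((B * h) * - 1#)) ∷ (B * h) ∷ [])))
                     (+ₚ-congˡ (const (- 1#)) (*ₚ-congʳ (const u) (≋-trans (∘ₚ-congʳ f γ⁻¹≋Y) f∘Y))) ⟩
        (-ₚ const 1#) +ₚ (const (B * h) *ₚ (const 1# +ₚ (-ₚ T (suc (m ℕ.+ m))))) *ₚ const u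
          ≈⟨ solveₚ 3 (λ W U S → (⊝ κ (+ 1)) ⊕ (W ⊛ (κ (+ 1) ⊕ ⊝ S)) ⊛ U ≐ (⊝ κ (+ 1)) ⊕ (U ⊛ W) ⊛ (κ (+ 1) ⊕ ⊝ S))
                    ≋-refl (const (B * h)) (const u) (T (suc (m ℕ.+ m))) ⟩
        (-ₚ const 1#) +ₚ (const u *ₚ const (B * h)) *ₚ (const 1# +ₚ (-ₚ T (suc (m ℕ.+ m))))
          ≈⟨ +ₚ-congˡ (-ₚ const 1#) (*ₚ-congʳ (const 1# +ₚ (-ₚ T (suc (m ℕ.+ m))))
                                              (≋-trans (const-*ₚ u (B * h)) (∷-cong uw≈1 (≋-refl {[]})))) ⟩
        (-ₚ const 1#) +ₚ const 1# *ₚ (const 1# +ₚ (-ₚ T (suc (m ℕ.+ m))))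
          ≈⟨ solveₚ 1 (λ S → (⊝ κ (+ 1)) ⊕ κ (+ 1) ⊛ (κ (+ 1) ⊕ ⊝ S) ≐ ⊝ S) ≋-refl (T (suc (m ℕ.+ m))) ⟩
        -ₚ T (suc (m ℕ.+ m))
          ∎

    -- Here f = B − x, and γ x = x − B / 2.
    conjugate-linear : ∀ {f} → f ≋ (A ·ₚ L) *ₚ (const a₀ *ₚ const a₀) → Conjugate f (-ₚ T 1)
    conjugate-linear {f} f≋ = conjugate-by {f} 1# (- (B * h)) 1# (*-identityʳ 1#) (≋-sym γfγ⁻¹≋-T)
      where
      Y = const B *ₚ const h +ₚ X
      γ⁻¹≋Y : (- (1# * - (B * h))) ∷ 1# ∷ [] ≋ Y
      γ⁻¹≋Y = ∷-cong (solve 2 (λ b h → :- (con (+ 1) :* (:- (b :* h))) := (b :* h :+ con (+ 0)) :+ con (+ 0)) refl B h)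
                     (∷-cong refl (≋-refl {[]}))

      f∘Y : f ∘ₚ Y ≋ (const A *ₚ (-ₚ const B +ₚ Y *ₚ const 1#)) *ₚ (const a₀ *ₚ const a₀)
      f∘Y = begin
        f ∘ₚ Y
          ≈⟨ ∘ₚ-congˡ Y f≋ ⟩
        ((A ·ₚ L) *ₚ (const a₀ *ₚ const a₀)) ∘ₚ Y
          ≈⟨ ≋-trans (∘ₚ-homo-*ₚ (A ·ₚ L) (const a₀ *ₚ const a₀) Y)
                     (*ₚ-cong (·ₚ-∘ₚ A L Y) (∘ₚ-homo-*ₚ (const a₀) (const a₀) Y)) ⟩
        (const A *ₚ (L ∘ₚ Y)) *ₚ ((const a₀ ∘ₚ Y) *ₚ (const a₀ ∘ₚ Y))
          ≈⟨ *ₚ-cong (*ₚ-congˡ (const A) (linear-∘ₚ (- B) 1# Y)) (*ₚ-cong (const-∘ₚ a₀ Y) (const-∘ₚ a₀ Y)) ⟩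
        (const A *ₚ (-ₚ const B +ₚ Y *ₚ const 1#)) *ₚ (const a₀ *ₚ const a₀)
          ∎

      γfγ⁻¹≋-T : (- (B * h) ∷ 1# ∷ []) ∘ₚ (f ∘ₚ ((- (1# * - (B * h))) ∷ 1# ∷ [])) ≋ -ₚ T 1
      γfγ⁻¹≋-T = begin
        (- (B * h) ∷ 1# ∷ []) ∘ₚ (f ∘ₚ ((- (1# * - (B * h))) ∷ 1# ∷ []))
          ≈⟨ ≋-trans (linear-∘ₚ (- (B * h)) 1# (f ∘ₚ ((- (1# * - (B * h))) ∷ 1# ∷ [])))
                     (+ₚ-cong (-ₚ-cong (≋-sym (const-*ₚ B h))) (*ₚ-congʳ (const 1#) (≋-trans (∘ₚ-congʳ f γ⁻¹≋Y) f∘Y))) ⟩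
        (-ₚ (const B *ₚ const h)) +ₚ ((const A *ₚ (-ₚ const B +ₚ Y *ₚ const 1#)) *ₚ (const a₀ *ₚ const a₀)) *ₚ const 1#
          ≈⟨ solveₚ 5 (λ A′ B′ H a Y′ → (⊝ (B′ ⊛ H)) ⊕ ((A′ ⊛ ((⊝ B′) ⊕ (B′ ⊛ H ⊕ Y′) ⊛ κ (+ 1))) ⊛ (a ⊛ a)) ⊛ κ (+ 1)
                                      ≐ (A′ ⊛ (a ⊛ a)) ⊛ ((⊝ B′) ⊕ B′ ⊛ H ⊕ Y′) ⊕ ⊝ (B′ ⊛ H))
                    ≋-refl (const A) (const B) (const h) (const a₀) X ⟩
        (const A *ₚ (const a₀ *ₚ const a₀)) *ₚ ((-ₚ const B) +ₚ const B *ₚ const h +ₚ X) +ₚ (-ₚ (const B *ₚ const h))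
          ≈⟨ +ₚ-congʳ (-ₚ (const B *ₚ const h)) (*ₚ-congʳ ((-ₚ const B) +ₚ const B *ₚ const h +ₚ X) Aa₀²≋-1) ⟩
        (-ₚ const 1#) *ₚ ((-ₚ const B) +ₚ const B *ₚ const h +ₚ X) +ₚ (-ₚ (const B *ₚ const h))
          ≈⟨ solveₚ 3 (λ B′ H Y′ → (⊝ κ (+ 1)) ⊛ ((⊝ B′) ⊕ B′ ⊛ H ⊕ Y′) ⊕ ⊝ (B′ ⊛ H) ≐ (⊝ Y′) ⊕ B′ ⊛ (κ (+ 1) ⊕ ⊝ (κ (+ 2) ⊛ H)))
                    ≋-refl (const B) (const h) X ⟩
        (-ₚ X) +ₚ const B *ₚ (const 1# +ₚ (-ₚ (const (1# + 1#) *ₚ const h)))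
          ≈⟨ +ₚ-congˡ (-ₚ X) (*ₚ-congˡ (const B) (+ₚ-congˡ (const 1#) (-ₚ-cong 2·h≋1))) ⟩
        (-ₚ X) +ₚ const B *ₚ (const 1# +ₚ (-ₚ const 1#))
          ≈⟨ solveₚ 2 (λ B′ Y′ → (⊝ Y′) ⊕ B′ ⊛ (κ (+ 1) ⊕ ⊝ κ (+ 1)) ≐ ⊝ Y′) ≋-refl (const B) X ⟩
        -ₚ X
          ∎

module Reduction {c ℓ : Level} (K : Field c ℓ) where
  open Field K hiding (zero)
  open FieldTheory K
  open FieldProperties K
  open Convolution commutativeRing using (VanishesAbove)
  open PolynomialRing K
  open Degrees K
  open Coefficients K
  open ChebyshevPolynomials K
  open Conjugation K
  open import Algebra.Properties.Semiring.Exp semiring using (_^_)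
  open import Algebra.Properties.Ring ring using (-‿injective; -0#≈0#; -‿distribʳ-*)
  open import Relation.Binary.Reasoning.Setoid setoid

  AdmissibleCharacteristic : ℕ → Set ℓ
  AdmissibleCharacteristic d = CharZero ⊎ (Σ ℕ λ p → HasChar p × ¬ (2 ∣ p) × d ≤ p)

  char-exceeds : ∀ {d N} → AdmissibleCharacteristic d → d ≡ suc N → CharExceeds N
  char-exceeds (inj₁ char0) _ (suc j) _ _ = char0 j
  char-exceeds (inj₂ (p , (_ , _ , minimal) , _ , d≤p)) ≡.refl j 0<j j≤N = minimal j 0<j (ℕ.<-≤-trans (s≤s j≤N) d≤p)

  char-2≉0 : ∀ {d} → AdmissibleCharacteristic d → ¬ ι 2 ≈ 0#
  char-2≉0 (inj₁ char0) = char0 1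
  char-2≉0 (inj₂ (1 , (_ , ι1≈0 , _) , _ , _)) _ = 1≉0 (trans (sym (+-identityʳ 1#)) ι1≈0)
  char-2≉0 (inj₂ (2 , _ , odd , _)) _ = odd (divides 1 ≡.refl)
  char-2≉0 (inj₂ (suc (suc (suc p)) , (_ , _ , minimal) , _ , _)) = minimal 2 (s≤s z≤n) (s≤s (s≤s (s≤s z≤n)))

  A·a₀²≈-1 : ∀ {A a₀} (A≉0 : ¬ A ≈ 0#) → a₀ * a₀ ≈ - inv A A≉0 → A * (a₀ * a₀) ≈ - 1#
  A·a₀²≈-1 {A} A≉0 a₀²≈ = trans (*-congˡ a₀²≈) (trans (sym (-‿distribʳ-* A _)) (-‿cong (inv-r A A≉0)))

  2≉0 : ¬ ι 2 ≈ 0# → ¬ 1# + 1# ≈ 0#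
  2≉0 ι2≉0 2≈0 = ι2≉0 (trans ι2≈1+1 2≈0)

  odd-degree : ∀ {A B d f} G → ¬ ι 2 ≈ 0# → ¬ A ≈ 0# → f ≋ (A ·ₚ ((- B) ∷ 1# ∷ [])) *ₚ (G *ₚ G) → HasDegree f d →
               Σ ℕ λ m → d ≡ suc (m ℕ.+ m) × HasDegree G m
  odd-degree {A} {B} G ι2≉0 A≉0 f≋ f-deg =
    let L*G²-deg = ·ₚ-HasDegree⁻¹ (L *ₚ (G *ₚ G)) A≉0 (HasDegree-resp (≋-trans f≋ (·ₚ-*ₚ A L (G *ₚ G))) f-deg)
        (d′ , d≡1+d′ , G²-deg) = linear-*ₚ-HasDegree⁻¹ (- B) (G *ₚ G) L*G²-deg
        (m , d′≡m+m , G-deg) = square-HasDegree (2≉0 ι2≉0) G G²-deg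
    in m , ≡.trans d≡1+d′ (≡.cong suc d′≡m+m) , G-deg
    where
    L = (- B) ∷ 1# ∷ []

  HasDegree-polyOf⇒≤ : ∀ a {n m} → HasDegree (polyOf a n) m → m ≤ n
  HasDegree-polyOf⇒≤ a {n} {m} (top≉0 , _) with m ℕ.≤? n
  ... | yes m≤n = m≤n
  ... | no  m≰n = contradiction (reflexive (polyOf-vanishesAbove a (ℕ.≰⇒> m≰n))) top≉0

  Recurrence-truncate : ∀ {B a n m} → ¬ ι 2 ≈ 0# → HasDegree (polyOf a n) m → Recurrence B a n → Recurrence B a m
  Recurrence-truncate {B} {a} {n} {m} ι2≉0 (top≉0 , above≈0) rec
    with ℕ.m≤n⇒m<n∨m≡n (HasDegree-polyOf⇒≤ a (top≉0 , above≈0))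
  ... | inj₂ ≡.refl = rec
  ... | inj₁ m<n    = Recurrence-restrict ι2≉0 am≉0 m<n a[1+m]≈0 rec
    where
    am≉0 : ¬ a m ≈ 0#
    am≉0 am≈0 = top≉0 (trans (reflexive (coeff-polyOf a (ℕ.<⇒≤ m<n))) am≈0)
    a[1+m]≈0 : a (suc m) ≈ 0#
    a[1+m]≈0 = trans (sym (reflexive (coeff-polyOf a m<n))) (above≈0 (suc m) ℕ.≤-refl)

  Recurrence⇒B≉0 : ∀ {B a m} → CharExceeds (m ℕ.+ m) → ¬ ι 2 ≈ 0# → ¬ a 0 ≈ 0# → 1 ≤ m → Recurrence B a m → ¬ B ≈ 0#
  Recurrence⇒B≉0 {B} {a} {suc m} char ι2≉0 a₀≉0 _ rec B≈0 =
    *-≉0 (*-≉0 (*-≉0 ι2≉0 (char (m ℕ.+ 1) (ℕ.m≤n+m 1 m) m+1≤2m+2))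
                (char (suc m ℕ.+ 1) (ℕ.m≤n+m 1 (suc m)) 1+m+1≤2m+2)) a₀≉0
      (-‿injective (begin
        - (ι 2 * ι (m ℕ.+ 1) * ι (suc m ℕ.+ 1) * a 0)        ≈⟨ rec 1 ℕ.≤-refl (s≤s z≤n) ⟨
        ι 1 * ι 1 * B * a 1                                    ≈⟨ *-congʳ (trans (*-congˡ B≈0) (zeroʳ _)) ⟩
        0# * a 1                                               ≈⟨ zeroˡ _ ⟩
        0#                                                     ≈⟨ -0#≈0# ⟨
        - 0#                                                   ∎))
    where
    m+1≤2m+2 : m ℕ.+ 1 ≤ suc m ℕ.+ suc m
    m+1≤2m+2 = ℕ.≤-trans (ℕ.≤-reflexive (ℕ.+-comm m 1)) (ℕ.m≤m+n (suc m) (suc m))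
    1+m+1≤2m+2 : suc m ℕ.+ 1 ≤ suc m ℕ.+ suc m
    1+m+1≤2m+2 = ℕ.+-monoʳ-≤ (suc m) (s≤s z≤n)

  dilate≋P : ∀ {B a m} G → CharExceeds (m ℕ.+ m) → Recurrence B a m → (∀ k → k ≤ m → coeff G k ≈ a k) →
             VanishesAbove m (coeff G) → dilate B G ≋ a 0 ·ₚ P m
  dilate≋P {B} {a} {m} G char rec G≈a G-above = coeffwise λ k →
    trans (coeff-dilate B G k) (trans (coefficient k) (sym (coeff-·ₚ (a 0) (P m) k)))
    where
    coefficient : ∀ k → B ^ k * coeff G k ≈ a 0 * coeff (P m) k
    coefficient k with k ℕ.≤? m
    ... | yes k≤m = trans (*-congˡ (G≈a k k≤m)) (trans (Recurrence⇒closed-form char rec k k≤m) (*-congˡ (sym (coeff-P m k))))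
    ... | no  k≰m = begin
      B ^ k * coeff G k    ≈⟨ *-congˡ (G-above k (ℕ.≰⇒> k≰m)) ⟩
      B ^ k * 0#           ≈⟨ zeroʳ _ ⟩
      0#                   ≈⟨ zeroʳ _ ⟨
      a 0 * 0#             ≡⟨ ≡.cong (a 0 *_) (polyOf-vanishesAbove (closedFormCoeff m) (ℕ.≰⇒> k≰m)) ⟨
      a 0 * coeff (P m) k  ∎

  conjugate-to-Chebyshev : ∀ {A B f n m} (a : ℕ → Carrier) → ¬ ι 2 ≈ 0# → CharExceeds (m ℕ.+ m) →
    A * (a 0 * a 0) ≈ - 1# → Recurrence B a n → HasDegree (polyOf a n) m →
    f ≋ (A ·ₚ ((- B) ∷ 1# ∷ [])) *ₚ (polyOf a n *ₚ polyOf a n) → Conjugate f (-ₚ T (suc (m ℕ.+ m)))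
  conjugate-to-Chebyshev {A} {B} {f} {n} {zero} a ι2≉0 char A·a₀²≈-1 rec (_ , above≈0) f≋ =
    conjugate-linear {B = B} A·a₀²≈-1 (inv-r _ (2≉0 ι2≉0))
      (≋-trans f≋ (*ₚ-congˡ (A ·ₚ ((- B) ∷ 1# ∷ [])) (*ₚ-cong G≋a₀ G≋a₀)))
    where
    G≋a₀ : polyOf a n ≋ const (a 0)
    G≋a₀ = coeffwise λ { zero → refl ; (suc k) → above≈0 (suc k) (s≤s z≤n) }
  conjugate-to-Chebyshev {A} {B} {f} {n} {m@(suc _)} a ι2≉0 char A·a₀²≈-1 rec G-deg f≋ =
    conjugate-odd {B = B} A·a₀²≈-1 (inv-r _ (2≉0 ι2≉0)) B≉0 m (polyOf a n)
      (dilate≋P (polyOf a n) char recₘ (λ k k≤m → reflexive (coeff-polyOf a (ℕ.≤-trans k≤m m≤n))) (proj₂ G-deg)) f≋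
    where
    m≤n = HasDegree-polyOf⇒≤ a G-deg
    recₘ = Recurrence-truncate ι2≉0 G-deg rec
    a₀≉0 : ¬ a 0 ≈ 0#
    a₀≉0 a₀≈0 = 1≉0 (-‿injective (begin
      - 1#                ≈⟨ A·a₀²≈-1 ⟨
      A * (a 0 * a 0)     ≈⟨ trans (*-congˡ (trans (*-congʳ a₀≈0) (zeroˡ _))) (zeroʳ A) ⟩
      0#                  ≈⟨ -0#≈0# ⟨
      - 0#                ∎))
    B≉0 = Recurrence⇒B≉0 char ι2≉0 a₀≉0 (s≤s z≤n) recₘ

proposition3p6 : {c ℓ : Level} (K : Field c ℓ) →
  let open Field K
      open FieldTheory K
  in (d : ℕ) →
     CharZero ⊎ (Σ ℕ λ p → HasChar p × ¬ (2 ∣ p) × d ≤ p) →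
     (f : Poly) → HasDegree f d →
     (A B : Carrier) (A≉0 : ¬ (A ≈ 0#)) (n : ℕ) (a : ℕ → Carrier) →
     a 0 * a 0 ≈ - inv A A≉0 →
     (∀ i → 1 ≤ i → i ≤ n →
        ι i * ι (2 ℕ.* i ∸ 1) * B * a i
          ≈ - (ι 2 * ι (n ∸ i ℕ.+ 1) * ι (n ℕ.+ i) * a (i ∸ 1))) →
     f ≈ₚ (A ·ₚ ((- B) ∷ 1# ∷ []) *ₚ (polyOf a n *ₚ polyOf a n)) →
     Conjugate f (-ₚ T d)
proposition3p6 K d char f f-deg A B A≉0 n a a₀²≈-A⁻¹ rec f≈ =
  let (m , d≡2m+1 , G-deg) = odd-degree (polyOf a n) ι2≉0 A≉0 f≋ f-deg
  in ≡.subst (λ e → Conjugate f (-ₚ T e)) (≡.sym d≡2m+1)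
       (conjugate-to-Chebyshev a ι2≉0 (char-exceeds char d≡2m+1)
                               (A·a₀²≈-1 A≉0 a₀²≈-A⁻¹) rec G-deg f≋)
  where
  open Field K
  open FieldTheory K
  open PolynomialRing K using (_≋_; coeffwise)
  open Reduction K

  ι2≉0 : ¬ ι 2 ≈ 0#
  ι2≉0 = char-2≉0 char

  f≋ : f ≋ (A ·ₚ ((- B) ∷ 1# ∷ [])) *ₚ (polyOf a n *ₚ polyOf a n)
  f≋ = coeffwise f≈
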